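{- Let $k,n$ be nonnegative integers of the same parity with $n\ge k$, and put $s=\frac12(n-k)$. Then $a_{k,n}$ equals the number of pairs $(c_1,c_2)$ satisfying all of the following: $c_1$ is an ordered composition of $k+2$ with all summands at least $2$; $c_2$ is an ordered composition of $n+2$ with all summands at least $2$; and $c_2$ has exactly $s$ more summands than $c_1$.
   Context: For nonnegative integers $k,n$, let $a_{k,n}$ be the number of ways to partition a set consisting of $k$ marked points on a line and $n$ marked points on a parallel line into pairs, joining the two points of each pair by a straight segment, such that no two segments have a common point (in particular, no endpoint lies on another segment). We have $a_{0,0}=1$. A composition of $m$ is a representation of $m$ as an ordered sum of positive integers. Sums differing in the order of the summands are considered different. -}

module Defs where

open import Data.Nat using (ℕ; zero; suc; _+_; _≤_; _≤ᵇ_; _<ᵇ_; _≡ᵇ_)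
open import Data.Nat.Properties using (_≟_; _≤?_)
open import Data.Bool using (Bool; true; false; _∧_; _∨_; _xor_; not)
open import Data.List using (List; []; _∷_; [_]; _++_; map; concatMap; upTo; length; filter; filterᵇ; cartesianProduct)
open import Data.Nat.ListAction using (sum)
open import Data.List.Relation.Unary.All using (All; all?)
open import Data.Vec using (Vec; []; _∷_; fromList)
open import Data.Product using (_×_; _,_; proj₁; proj₂)
open import Relation.Binary.PropositionalEquality using (_≡_)
open import Relation.Nullary using (Dec)
open import Relation.Nullary.Decidable using (_×-dec_)

-- The k points on the first ("top") line are
-- top 0, …, top (k-1), in this order along the line; the n points on
-- the parallel ("bottom") line are bot 0, …, bot (n-1), in this order
-- (both lines oriented the same way).

data Pt : Set where
  top : ℕ → Pt
  bot : ℕ → Pt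

points : ℕ → ℕ → List Pt
points k n = map top (upTo k) ++ map bot (upTo n)

-- Straight segments joining two marked points.
--   onTop a b : segment inside the top line from position a to b (a ≤ b)
--   onBot a b : segment inside the bottom line from position a to b
--   cross i j : segment from top i to bot j (crosses the strip)

data Seg : Set where
  onTop : ℕ → ℕ → Seg
  onBot : ℕ → ℕ → Seg
  cross : ℕ → ℕ → Seg

min max : ℕ → ℕ → ℕ
min a b = if′ (a ≤ᵇ b) a b
  where
  if′ : Bool → ℕ → ℕ → ℕ
  if′ true x _ = x
  if′ false _ y = y
max a b = if′ (a ≤ᵇ b) b a
  where
  if′ : Bool → ℕ → ℕ → ℕ
  if′ true x _ = x
  if′ false _ y = y

segment : Pt × Pt → Seg
segment (top a , top b) = onTop (min a b) (max a b)
segment (bot a , bot b) = onBot (min a b) (max a b)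
segment (top i , bot j) = cross i j
segment (bot j , top i) = cross i j

-- "The two straight segments have a common point" (geometric fact for
-- segments with endpoints on two distinct parallel lines):
--  * two segments in the same line meet iff their intervals overlap;
--  * segments in different lines never meet;
--  * a segment [a,b] in a line meets a crossing segment iff the
--    crossing segment's endpoint on that line lies in [a,b];
--  * crossing segments (i,j),(i',j') meet iff they share an endpoint
--    or their orders are reversed (i < i' but j' < j, or vice versa).
meet : Seg → Seg → Bool
meet (onTop a b) (onTop c d) = (c ≤ᵇ b) ∧ (a ≤ᵇ d)
meet (onTop a b) (onBot c d) = false
meet (onTop a b) (cross i j) = (a ≤ᵇ i) ∧ (i ≤ᵇ b)
meet (onBot a b) (onTop c d) = false
meet (onBot a b) (onBot c d) = (c ≤ᵇ b) ∧ (a ≤ᵇ d)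
meet (onBot a b) (cross i j) = (a ≤ᵇ j) ∧ (j ≤ᵇ b)
meet (cross i j) (onTop a b) = (a ≤ᵇ i) ∧ (i ≤ᵇ b)
meet (cross i j) (onBot a b) = (a ≤ᵇ j) ∧ (j ≤ᵇ b)
meet (cross i j) (cross i' j') =
  (i ≡ᵇ i') ∨ (j ≡ᵇ j') ∨ ((i <ᵇ i') xor (j <ᵇ j'))

pairwiseDisjoint : List Seg → Bool
pairwiseDisjoint [] = true
pairwiseDisjoint (s ∷ ss) = noneMeet ss ∧ pairwiseDisjoint ss
  where
  noneMeet : List Seg → Bool
  noneMeet [] = true
  noneMeet (t ∷ ts) = not (meet s t) ∧ noneMeet ts

-- All partitions of a list of (distinct) points into pairs, each
-- partition listed exactly once: pair the first point with each of the
-- other points and recurse on the remaining ones.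

picks : ∀ {A : Set} {m} → Vec A (suc m) → List (A × Vec A m)
picks {m = zero} (x ∷ []) = [ (x , []) ]
picks {m = suc m} (x ∷ xs) =
  (x , xs) ∷ map (λ p → proj₁ p , (x ∷ proj₂ p)) (picks xs)

pairings : ∀ {A : Set} m → Vec A m → List (List (A × A))
pairings zero [] = [ [] ]
pairings (suc zero) (x ∷ []) = []
pairings (suc (suc m)) (x ∷ xs) =
  concatMap (λ p → map ((x , proj₁ p) ∷_) (pairings m (proj₂ p))) (picks xs)

a : ℕ → ℕ → ℕ
a k n = length (filterᵇ (λ P → pairwiseDisjoint (map segment P))
                        (pairings (length ps) (fromList ps)))
  where ps = points k n

IsCompositionGe2 : ℕ → List ℕ → Set
IsCompositionGe2 m c = All (2 ≤_) c × sum c ≡ m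

isCompositionGe2? : ∀ m c → Dec (IsCompositionGe2 m c)
isCompositionGe2? m c = all? (2 ≤?_) c ×-dec (sum c ≟ m)

boundedLists : ℕ → ℕ → List (List ℕ)
boundedLists zero B = [ [] ]
boundedLists (suc L) B =
  [] ∷ concatMap (λ x → map (x ∷_) (boundedLists L B)) (upTo (suc B))

-- the list of all compositions of m with summands ≥ 2 (a composition
-- of m has at most m summands, each ≤ m)
compositionsGe2 : ℕ → List (List ℕ)
compositionsGe2 m = filter (isCompositionGe2? m) (boundedLists m m)

{-# OPTIONS --safe #-}

-- Let N(k, n) count the non-crossing pairings of k points on the top line and n
-- on the bottom line, and T_m(c) the compositions of m with parts ≥ 2 and excess
-- Σ (part − 2) = c. As 2 · #parts + excess = m, for n = k + 2s the pairs counted on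
-- the right are exactly those of equal excess, so the right-hand side is
-- Σ_c T_{k+2}(c) T_{n+2}(c). Both sides obey the same recursion in k. The first
-- top point is joined either to its neighbour, leaving k − 2 top points, or to a
-- bottom point c; then the bottom points left of c can only be joined among
-- themselves, in adjacent pairs, which is possible exactly when their number is
-- even, and what remains is an instance with k − 1 top points. On the side of
-- compositions the same recursion comes from looking at the first part:
-- T_{m+2}(c + 1) = T_m(c + 1) + T_{m+1}(c), and N(0, n) = T_{n+2}(0) = [n even].

module Submission where

open import Defs

open import Algebra.Bundles using (CommutativeMonoid)
open import Data.Bool using (Bool; true; false; _∧_; not; if_then_else_; T)
open import Data.Bool.ListAction using (all)
import Data.Bool.Properties as Bool
open import Data.Empty using (⊥; ⊥-elim)
open import Data.List
  using (List; []; _∷_; _++_; map; concatMap; length; filter; filterᵇ; cartesianProduct; applyUpTo; upTo)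
open import Data.List.Membership.Propositional using (_∈_)
open import Data.List.Membership.Propositional.Properties using (∈-map⁻; ∈-filter⁻; ∈-++⁻; ∈-++⁺ˡ; ∈-++⁺ʳ)
open import Data.List.Properties
  using (map-++; map-∘; map-cong; map-id; map-applyUpTo; ++-identityʳ;
         filter-≐; filter-accept; filter-reject; filter-all; filter-none; filter-++)
open import Data.List.Relation.Binary.Subset.Propositional using (_⊆_)
open import Data.List.Relation.Binary.Subset.Propositional.Properties
  using (∷⁺ʳ; ++⁺ˡ; ++⁺ʳ; xs⊆x∷xs; xs⊆xs++ys; xs⊆ys++xs)
open import Data.List.Relation.Unary.All using (All; all?; tabulate)
import Data.List.Relation.Unary.All as All
open import Data.List.Relation.Unary.Any using (here; there)
open import Data.Nat using (ℕ; zero; suc; _+_; _*_; _≤_; _<_; _∸_; _/_; _%_; _⊓_; _⊔_; z≤n; s≤s; _≤ᵇ_; _<ᵇ_; _≡ᵇ_)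
open import Data.Nat.DivMod using (m≡m%n+[m/n]*n; m*n/n≡m)
open import Data.Nat.ListAction using (sum)
open import Data.Nat.ListAction.Properties using (sum-++)
open import Data.Nat.Properties using (_≟_; _≤?_; _<?_)
import Data.Nat.Properties as ℕ
open import Data.Nat.Solver using (module +-*-Solver)
open +-*-Solver using (solve; _:+_; _:*_; _:=_; con)
open import Data.Product using (∃; _×_; _,_; proj₁; proj₂; map₂)
open import Data.Sum using (_⊎_; inj₁; inj₂)
open import Data.Vec using (Vec; toList; fromList)
import Data.Vec as Vec
open import Data.Vec.Properties using (toList∘fromList)
open import Function using (_∘_; _⇔_; mk⇔)
open import Relation.Binary.PropositionalEquality
  using (_≡_; _≢_; _≗_; refl; sym; trans; cong; cong₂; subst; module ≡-Reasoning)
open import Relation.Nullary using (does; yes; no; ¬_; Reflects; ofʸ; ofⁿ)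
open import Relation.Nullary.Decidable using (T?; decidable-stable; does-⇔)
open import Relation.Nullary.Reflects using (fromEquivalence)
open import Relation.Unary using (Decidable; ∁)
open import Relation.Unary.Properties using (∁?)

open import Algebra.Properties.CommutativeSemigroup (CommutativeMonoid.commutativeSemigroup Bool.∧-commutativeMonoid)
  using () renaming (interchange to ∧-interchange)
open import Algebra.Properties.CommutativeSemigroup ℕ.+-commutativeSemigroup
  using () renaming (interchange to +-interchange)

∑ : {A : Set} → (A → ℕ) → List A → ℕ
∑ f xs = sum (map f xs)

∑-++ : ∀ {A : Set} (f : A → ℕ) xs ys → ∑ f (xs ++ ys) ≡ ∑ f xs + ∑ f ys
∑-++ f xs ys = trans (cong sum (map-++ f xs ys)) (sum-++ (map f xs) (map f ys))

∑-map : ∀ {A B : Set} (f : B → ℕ) (g : A → B) xs → ∑ f (map g xs) ≡ ∑ (f ∘ g) xs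
∑-map f g xs = cong sum (sym (map-∘ xs))

∑-concatMap : ∀ {A B : Set} (f : B → ℕ) (g : A → List B) xs → ∑ f (concatMap g xs) ≡ ∑ (∑ f ∘ g) xs
∑-concatMap f g []       = refl
∑-concatMap f g (x ∷ xs) = trans (∑-++ f (g x) (concatMap g xs)) (cong (∑ f (g x) +_) (∑-concatMap f g xs))

∑-cong : ∀ {A : Set} {f g : A → ℕ} → f ≗ g → ∀ xs → ∑ f xs ≡ ∑ g xs
∑-cong f≗g xs = cong sum (map-cong f≗g xs)

∑-cong-∈ : ∀ {A : Set} {f g : A → ℕ} xs → (∀ {x} → x ∈ xs → f x ≡ g x) → ∑ f xs ≡ ∑ g xs
∑-cong-∈ []       f≡g = refl
∑-cong-∈ (x ∷ xs) f≡g = cong₂ _+_ (f≡g (here refl)) (∑-cong-∈ xs (f≡g ∘ there))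

∑-≡0 : ∀ {A : Set} {f : A → ℕ} xs → (∀ {x} → x ∈ xs → f x ≡ 0) → ∑ f xs ≡ 0
∑-≡0 []       f≡0 = refl
∑-≡0 (x ∷ xs) f≡0 = cong₂ _+_ (f≡0 (here refl)) (∑-≡0 xs (f≡0 ∘ there))

∑-distribʳ-* : ∀ {A : Set} (f : A → ℕ) c xs → ∑ (λ x → f x * c) xs ≡ ∑ f xs * c
∑-distribʳ-* f c []       = refl
∑-distribʳ-* f c (x ∷ xs) = trans (cong (f x * c +_) (∑-distribʳ-* f c xs)) (sym (ℕ.*-distribʳ-+ c (f x) (∑ f xs)))

∑-if : ∀ {A : Set} b (f : A → ℕ) xs → ∑ (λ x → if b then f x else 0) xs ≡ (if b then ∑ f xs else 0)
∑-if true  f xs = refl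
∑-if false f xs = ∑-≡0 xs (λ _ → refl)

if-* : ∀ b m n → (if b then m else 0) * n ≡ (if b then m * n else 0)
if-* true  m n = refl
if-* false m n = refl

if-∧ : ∀ b c {x : ℕ} → (if b ∧ c then x else 0) ≡ (if b then (if c then x else 0) else 0)
if-∧ true  c = refl
if-∧ false c = refl

if-zero : ∀ b {n} → n ≡ 0 → (if b then n else 0) ≡ 0
if-zero true  n≡0 = n≡0
if-zero false n≡0 = refl

module _ {A : Set} {P : A → Set} (P? : Decidable P) where

  ∑-filter : ∀ (f : A → ℕ) xs → ∑ f (filter P? xs) ≡ ∑ (λ x → if does (P? x) then f x else 0) xs
  ∑-filter f []       = refl
  ∑-filter f (x ∷ xs) with does (P? x)
  ... | true  = cong (f x +_) (∑-filter f xs)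
  ... | false = ∑-filter f xs

  length-filter : ∀ xs → length (filter P? xs) ≡ ∑ (λ x → if does (P? x) then 1 else 0) xs
  length-filter []       = refl
  length-filter (x ∷ xs) with does (P? x)
  ... | true  = cong suc (length-filter xs)
  ... | false = length-filter xs

∑-cartesianProduct : ∀ {A B : Set} (f : A × B → ℕ) xs ys →
                     ∑ f (cartesianProduct xs ys) ≡ ∑ (λ x → ∑ (λ y → f (x , y)) ys) xs
∑-cartesianProduct f []       ys = refl
∑-cartesianProduct f (x ∷ xs) ys = trans (∑-++ f (map (x ,_) ys) (cartesianProduct xs ys))
  (cong₂ _+_ (∑-map f (x ,_) ys) (∑-cartesianProduct f xs ys))

∑< : ℕ → (ℕ → ℕ) → ℕ
∑< zero    f = 0
∑< (suc n) f = f 0 + ∑< n (f ∘ suc)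

∑<-cong : ∀ n {f g : ℕ → ℕ} → (∀ {c} → c < n → f c ≡ g c) → ∑< n f ≡ ∑< n g
∑<-cong zero    f≡g = refl
∑<-cong (suc n) f≡g = cong₂ _+_ (f≡g (s≤s z≤n)) (∑<-cong n (f≡g ∘ s≤s))

∑<-≡0 : ∀ n {f : ℕ → ℕ} → (∀ c → f c ≡ 0) → ∑< n f ≡ 0
∑<-≡0 zero    f≡0 = refl
∑<-≡0 (suc n) f≡0 = cong₂ _+_ (f≡0 0) (∑<-≡0 n (f≡0 ∘ suc))

∑<-distrib-+ : ∀ n (f g : ℕ → ℕ) → ∑< n (λ c → f c + g c) ≡ ∑< n f + ∑< n g
∑<-distrib-+ zero    f g = refl
∑<-distrib-+ (suc n) f g =
  trans (cong (f 0 + g 0 +_) (∑<-distrib-+ n (f ∘ suc) (g ∘ suc))) (+-interchange (f 0) (g 0) _ _)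

∑<-truncate : ∀ m n (f : ℕ → ℕ) → m ≤ n → (∀ {c} → m ≤ c → f c ≡ 0) → ∑< n f ≡ ∑< m f
∑<-truncate zero    n       f _         f≡0 = ∑<-≡0 n (λ c → f≡0 z≤n)
∑<-truncate (suc m) (suc n) f (s≤s m≤n) f≡0 = cong (f 0 +_) (∑<-truncate m n (f ∘ suc) m≤n (f≡0 ∘ s≤s))

∑<-upTo : ∀ n (f : ℕ → ℕ) → ∑ f (upTo n) ≡ ∑< n f
∑<-upTo n f = go n (λ i → i)
  where
  go : ∀ n (g : ℕ → ℕ) → ∑ f (applyUpTo g n) ≡ ∑< n (f ∘ g)
  go zero    g = refl
  go (suc n) g = cong (f (g 0) +_) (go n (g ∘ suc))

∑<-point : ∀ n v (g : ℕ → ℕ) → v < n → ∑< n (λ c → (if v ≡ᵇ c then 1 else 0) * g c) ≡ g v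
∑<-point (suc n) zero    g _         = trans (cong₂ _+_ (ℕ.+-identityʳ (g 0)) (∑<-≡0 n (λ _ → refl))) (ℕ.+-identityʳ (g 0))
∑<-point (suc n) (suc v) g (s≤s v<n) = ∑<-point n v (g ∘ suc) v<n

∑-fibres : ∀ {A : Set} (f : A → ℕ) (g : ℕ → ℕ) n xs → (∀ {x} → x ∈ xs → f x < n) →
           ∑ (g ∘ f) xs ≡ ∑< n (λ c → ∑ (λ x → if f x ≡ᵇ c then 1 else 0) xs * g c)
∑-fibres f g n []       _   = sym (∑<-≡0 n (λ _ → refl))
∑-fibres f g n (x ∷ xs) f<n = begin
  g (f x) + ∑ (g ∘ f) xs
    ≡⟨ cong₂ _+_ (sym (∑<-point n (f x) g (f<n (here refl)))) (∑-fibres f g n xs (f<n ∘ there)) ⟩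
  ∑< n (λ c → hits c x * g c) + ∑< n (λ c → ∑ (hits c) xs * g c)
    ≡⟨ sym (∑<-distrib-+ n (λ c → hits c x * g c) (λ c → ∑ (hits c) xs * g c)) ⟩
  ∑< n (λ c → hits c x * g c + ∑ (hits c) xs * g c)
    ≡⟨ ∑<-cong n (λ {c} _ → sym (ℕ.*-distribʳ-+ (g c) (hits c x) (∑ (hits c) xs))) ⟩
  ∑< n (λ c → ∑ (hits c) (x ∷ xs) * g c) ∎
  where
  open ≡-Reasoning
  hits : ℕ → _ → ℕ
  hits c y = if f y ≡ᵇ c then 1 else 0

choices : {A : Set} → List A → List (A × List A)
choices []       = []
choices (x ∷ xs) = (x , xs) ∷ map (map₂ (x ∷_)) (choices xs)

∈-choices⁻ : ∀ {A : Set} {xs : List A} {y rest} → (y , rest) ∈ choices xs →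
             y ∈ xs × rest ⊆ xs × suc (length rest) ≡ length xs
∈-choices⁻ {xs = x ∷ xs} (here refl) = here refl , there , refl
∈-choices⁻ {xs = x ∷ xs} (there yr∈) with ∈-map⁻ (map₂ (x ∷_)) yr∈
... | (y , rest) , yr∈′ , refl with ∈-choices⁻ yr∈′
...   | y∈ , rest⊆ , len = there y∈ , ∷⁺ʳ x rest⊆ , cong suc len

filter-map : ∀ {A B : Set} {P : B → Set} (P? : Decidable P) (f : A → B) xs →
             filter P? (map f xs) ≡ map f (filter (P? ∘ f) xs)
filter-map P? f []       = refl
filter-map P? f (x ∷ xs) with does (P? (f x))
... | true  = cong (f x ∷_) (filter-map P? f xs)
... | false = filter-map P? f xs

choices-filter : ∀ {A : Set} {P : A → Set} (P? : Decidable P) xs →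
                 choices (filter P? xs) ≡ map (map₂ (filter P?)) (filter (P? ∘ proj₁) (choices xs))
choices-filter P? []       = refl
choices-filter P? (x ∷ xs) with P? x
... | yes px = cong ((x , filter P? xs) ∷_) (begin
  map (map₂ (x ∷_)) (choices (filter P? xs))       ≡⟨ cong (map (map₂ (x ∷_))) (choices-filter P? xs) ⟩
  map (map₂ (x ∷_)) (map (map₂ (filter P?)) F)     ≡⟨ sym (map-∘ F) ⟩
  map (map₂ ((x ∷_) ∘ filter P?)) F                ≡⟨ map-cong (λ p → cong (proj₁ p ,_) (sym (filter-accept P? px))) F ⟩
  map (map₂ (filter P? ∘ (x ∷_))) F                ≡⟨ map-∘ F ⟩
  map (map₂ (filter P?)) (map (map₂ (x ∷_)) F)     ≡⟨ cong (map (map₂ (filter P?))) filter-map-choices ⟨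
  map (map₂ (filter P?)) (filter (P? ∘ proj₁) (map (map₂ (x ∷_)) (choices xs))) ∎)
  where
  open ≡-Reasoning
  F = filter (P? ∘ proj₁) (choices xs)
  filter-map-choices = filter-map (P? ∘ proj₁) (map₂ (x ∷_)) (choices xs)
... | no ¬px = begin
  choices (filter P? xs)                           ≡⟨ choices-filter P? xs ⟩
  map (map₂ (filter P?)) F                         ≡⟨ map-cong (λ p → cong (proj₁ p ,_) (sym (filter-reject P? ¬px))) F ⟩
  map (map₂ (filter P? ∘ (x ∷_))) F                ≡⟨ map-∘ F ⟩
  map (map₂ (filter P?)) (map (map₂ (x ∷_)) F)     ≡⟨ cong (map (map₂ (filter P?))) filter-map-choices ⟨
  map (map₂ (filter P?)) (filter (P? ∘ proj₁) (map (map₂ (x ∷_)) (choices xs))) ∎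
  where
  open ≡-Reasoning
  F = filter (P? ∘ proj₁) (choices xs)
  filter-map-choices = filter-map (P? ∘ proj₁) (map₂ (x ∷_)) (choices xs)

filter-choices-rest : ∀ {A : Set} {P : A → Set} (P? : Decidable P) {xs : List A} {y rest} →
                      (y , rest) ∈ choices xs → ¬ P y → filter P? rest ≡ filter P? xs
filter-choices-rest P? {x ∷ xs} (here refl) ¬py = sym (filter-reject P? ¬py)
filter-choices-rest P? {x ∷ xs} (there yr∈) ¬py with ∈-map⁻ (map₂ (x ∷_)) yr∈
... | (y , rest) , yr∈′ , refl with P? x
...   | yes px = cong (x ∷_) (filter-choices-rest P? yr∈′ ¬py)
...   | no ¬px = filter-choices-rest P? yr∈′ ¬py

choices-++ : ∀ {A : Set} (ys zs : List A) →
  choices (ys ++ zs) ≡ map (map₂ (_++ zs)) (choices ys) ++ map (map₂ (ys ++_)) (choices zs)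
choices-++ []       zs = sym (map-id (choices zs))
choices-++ (y ∷ ys) zs = cong ((y , ys ++ zs) ∷_) (begin
  map (map₂ (y ∷_)) (choices (ys ++ zs))
    ≡⟨ cong (map (map₂ (y ∷_))) (choices-++ ys zs) ⟩
  map (map₂ (y ∷_)) (map (map₂ (_++ zs)) (choices ys) ++ map (map₂ (ys ++_)) (choices zs))
    ≡⟨ map-++ (map₂ (y ∷_)) (map (map₂ (_++ zs)) (choices ys)) (map (map₂ (ys ++_)) (choices zs)) ⟩
  map (map₂ (y ∷_)) (map (map₂ (_++ zs)) (choices ys)) ++ map (map₂ (y ∷_)) (map (map₂ (ys ++_)) (choices zs))
    ≡⟨ cong₂ _++_ (trans (sym (map-∘ (choices ys))) (map-∘ (choices ys))) (sym (map-∘ (choices zs))) ⟩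
  map (map₂ (_++ zs)) (map (map₂ (y ∷_)) (choices ys)) ++ map (map₂ ((y ∷ ys) ++_)) (choices zs) ∎)
  where open ≡-Reasoning

-- Counting non-crossing pairings

noneMeet : Seg → List Seg → Bool
noneMeet s []       = true
noneMeet s (t ∷ ts) = not (meet s t) ∧ noneMeet s ts

-- Defs tests the head segment against the tail with a where-local function,
-- which Agda lifts over the clause variables; unification names it here.
mutual
  private
    noneMeetᴰ : Seg → List Seg → List Seg → Bool
    noneMeetᴰ = _

    pairwiseDisjoint-∷∷ : ∀ s t ts →
      pairwiseDisjoint (s ∷ t ∷ ts) ≡ (not (meet s t) ∧ noneMeetᴰ s (t ∷ ts) ts) ∧ pairwiseDisjoint (t ∷ ts)
    pairwiseDisjoint-∷∷ s t ts with t ∷ ts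
    ... | w = refl

private
  noneMeetᴰ≡noneMeet : ∀ s w ts → noneMeetᴰ s w ts ≡ noneMeet s ts
  noneMeetᴰ≡noneMeet s w []       = refl
  noneMeetᴰ≡noneMeet s w (t ∷ ts) = cong (not (meet s t) ∧_) (noneMeetᴰ≡noneMeet s w ts)

pairwiseDisjoint-∷ : ∀ s ss → pairwiseDisjoint (s ∷ ss) ≡ noneMeet s ss ∧ pairwiseDisjoint ss
pairwiseDisjoint-∷ s []       = refl
pairwiseDisjoint-∷ s (t ∷ ts) =
  trans (pairwiseDisjoint-∷∷ s t ts)
        (cong (λ b → (not (meet s t) ∧ b) ∧ pairwiseDisjoint (t ∷ ts)) (noneMeetᴰ≡noneMeet s (t ∷ ts) ts))

avoid : Seg → (Seg → Bool) → Seg → Bool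
avoid s φ t = φ t ∧ not (meet s t)

avoid-disjoint : ∀ s φ {t} → meet s t ≡ false → avoid s φ t ≡ φ t
avoid-disjoint s φ {t} s∩t≡∅ rewrite s∩t≡∅ = Bool.∧-identityʳ (φ t)

avoid-meeting : ∀ s φ {t} → meet s t ≡ true → avoid s φ t ≡ false
avoid-meeting s φ {t} s∩t rewrite s∩t = Bool.∧-zeroʳ (φ t)

avoid-forbidden : ∀ s φ {t} → φ t ≡ false → avoid s φ t ≡ false
avoid-forbidden s φ t∉φ rewrite t∉φ = refl

all-avoid : ∀ s φ ts → all (avoid s φ) ts ≡ all φ ts ∧ noneMeet s ts
all-avoid s φ []       = refl
all-avoid s φ (t ∷ ts) with φ t | meet s t
... | true  | true  = sym (Bool.∧-zeroʳ (all φ ts))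
... | true  | false = all-avoid s φ ts
... | false | _     = refl

valid : (Seg → Bool) → List (Pt × Pt) → Bool
valid φ P = all φ (map segment P) ∧ pairwiseDisjoint (map segment P)

valid-∷ : ∀ φ pq P → valid φ (pq ∷ P) ≡ φ (segment pq) ∧ valid (avoid (segment pq) φ) P
valid-∷ φ pq P = begin
  (φ s ∧ all φ S) ∧ pairwiseDisjoint (s ∷ S)
    ≡⟨ cong ((φ s ∧ all φ S) ∧_) (pairwiseDisjoint-∷ s S) ⟩
  (φ s ∧ all φ S) ∧ (noneMeet s S ∧ pairwiseDisjoint S)
    ≡⟨ Bool.∧-assoc (φ s) _ _ ⟩
  φ s ∧ (all φ S ∧ (noneMeet s S ∧ pairwiseDisjoint S))
    ≡⟨ cong (φ s ∧_) (sym (Bool.∧-assoc (all φ S) _ _)) ⟩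
  φ s ∧ ((all φ S ∧ noneMeet s S) ∧ pairwiseDisjoint S)
    ≡⟨ cong (λ b → φ s ∧ (b ∧ pairwiseDisjoint S)) (sym (all-avoid s φ S)) ⟩
  φ s ∧ valid (avoid s φ) P ∎
  where
  open ≡-Reasoning
  s = segment pq
  S = map segment P

-- #ncᶠ m φ xs counts the pairings of xs into pairwise disjoint segments allowed
-- by φ; m is the length of xs, an index that makes the recursion structural.
mutual
  #ncᶠ : ℕ → (Seg → Bool) → List Pt → ℕ
  #ncᶠ zero          φ _        = 1
  #ncᶠ (suc zero)    φ _        = 0
  #ncᶠ (suc (suc m)) φ []       = 0
  #ncᶠ (suc (suc m)) φ (x ∷ xs) = ∑ (joinᶠ m φ x) (choices xs)

  joinᶠ : ℕ → (Seg → Bool) → Pt → Pt × List Pt → ℕ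
  joinᶠ m φ x (y , rest) = if φ (segment (x , y)) then #ncᶠ m (avoid (segment (x , y)) φ) rest else 0

choices-toList : ∀ {A : Set} m (v : Vec A (suc m)) → choices (toList v) ≡ map (map₂ toList) (picks v)
choices-toList zero    (x Vec.∷ Vec.[]) = refl
choices-toList (suc m) (x Vec.∷ xs)     = cong ((x , toList xs) ∷_) (begin
  map (map₂ (x ∷_)) (choices (toList xs))                           ≡⟨ cong (map (map₂ (x ∷_))) (choices-toList m xs) ⟩
  map (map₂ (x ∷_)) (map (map₂ toList) (picks xs))                  ≡⟨ sym (map-∘ (picks xs)) ⟩
  map (map₂ toList ∘ map₂ (x Vec.∷_)) (picks xs)                     ≡⟨ map-∘ (picks xs) ⟩
  map (map₂ toList) (map (λ p → proj₁ p , (x Vec.∷ proj₂ p)) (picks xs)) ∎)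
  where open ≡-Reasoning

#valid-pairings : ∀ m (v : Vec Pt m) φ → length (filterᵇ (valid φ) (pairings m v)) ≡ #ncᶠ m φ (toList v)
#valid-pairings zero          Vec.[]                 φ = refl
#valid-pairings (suc zero)    (x Vec.∷ Vec.[])       φ = refl
#valid-pairings (suc (suc m)) (x Vec.∷ xs)           φ = begin
  length (filterᵇ (valid φ) (concatMap extend (picks xs)))  ≡⟨ length-filter (T? ∘ valid φ) (concatMap extend (picks xs)) ⟩
  ∑ count (concatMap extend (picks xs))                      ≡⟨ ∑-concatMap count extend (picks xs) ⟩
  ∑ (∑ count ∘ extend) (picks xs)                            ≡⟨ ∑-cong byFirstPair (picks xs) ⟩
  ∑ (joinᶠ m φ x ∘ map₂ toList) (picks xs)                   ≡⟨ sym (∑-map (joinᶠ m φ x) (map₂ toList) (picks xs)) ⟩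
  ∑ (joinᶠ m φ x) (map (map₂ toList) (picks xs))             ≡⟨ cong (∑ (joinᶠ m φ x)) (sym (choices-toList m xs)) ⟩
  ∑ (joinᶠ m φ x) (choices (toList xs))                      ∎
  where
  open ≡-Reasoning
  extend : Pt × Vec Pt m → List (List (Pt × Pt))
  extend (y , rest) = map ((x , y) ∷_) (pairings m rest)
  count : List (Pt × Pt) → ℕ
  count P = if valid φ P then 1 else 0
  byFirstPair : ∀ p → ∑ count (extend p) ≡ joinᶠ m φ x (map₂ toList p)
  byFirstPair (y , rest) = begin
    ∑ count (map ((x , y) ∷_) (pairings m rest))
      ≡⟨ ∑-map count ((x , y) ∷_) (pairings m rest) ⟩
    ∑ (λ P → count ((x , y) ∷ P)) (pairings m rest)
      ≡⟨ ∑-cong (λ P → trans (cong (λ b → if b then 1 else 0) (valid-∷ φ (x , y) P)) (if-∧ (φ s) _)) (pairings m rest) ⟩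
    ∑ (λ P → if φ s then (if valid (avoid s φ) P then 1 else 0) else 0) (pairings m rest)
      ≡⟨ ∑-if (φ s) _ (pairings m rest) ⟩
    (if φ s then ∑ (λ P → if valid (avoid s φ) P then 1 else 0) (pairings m rest) else 0)
      ≡⟨ cong (if φ s then_else 0) (sym (length-filter (T? ∘ valid (avoid s φ)) (pairings m rest))) ⟩
    (if φ s then length (filterᵇ (valid (avoid s φ)) (pairings m rest)) else 0)
      ≡⟨ cong (if φ s then_else 0) (#valid-pairings m rest (avoid s φ)) ⟩
    joinᶠ m φ x (y , toList rest) ∎
    where s = segment (x , y)

#nc : (Seg → Bool) → List Pt → ℕ
#nc φ xs = #ncᶠ (length xs) φ xs

a≡#nc : ∀ k n → a k n ≡ #nc (λ _ → true) (points k n)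
a≡#nc k n = begin
  length (filterᵇ (pairwiseDisjoint ∘ map segment) (pairings (length ps) (fromList ps)))
    ≡⟨ cong length (filter-≐ (T? ∘ (pairwiseDisjoint ∘ map segment)) (T? ∘ valid (λ _ → true))
                              ((λ {P} → subst T (sym (valid-true P))) , (λ {P} → subst T (valid-true P)))
                              (pairings (length ps) (fromList ps))) ⟩
  length (filterᵇ (valid (λ _ → true)) (pairings (length ps) (fromList ps)))
    ≡⟨ #valid-pairings (length ps) (fromList ps) (λ _ → true) ⟩
  #ncᶠ (length ps) (λ _ → true) (toList (fromList ps))
    ≡⟨ cong (#ncᶠ (length ps) (λ _ → true)) (toList∘fromList ps) ⟩
  #nc (λ _ → true) ps ∎
  where
  open ≡-Reasoning
  ps = points k n
  all-true : ∀ (ss : List Seg) → all (λ _ → true) ss ≡ true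
  all-true []       = refl
  all-true (s ∷ ss) = all-true ss
  valid-true : ∀ P → valid (λ _ → true) P ≡ pairwiseDisjoint (map segment P)
  valid-true P = cong (_∧ pairwiseDisjoint (map segment P)) (all-true (map segment P))

join : (Seg → Bool) → Pt → Pt × List Pt → ℕ
join φ x (y , rest) = if φ (segment (x , y)) then #nc (avoid (segment (x , y)) φ) rest else 0

#nc-∷ : ∀ φ x xs → #nc φ (x ∷ xs) ≡ ∑ (join φ x) (choices xs)
#nc-∷ φ x []       = refl
#nc-∷ φ x (y ∷ ys) = ∑-cong-∈ (choices (y ∷ ys)) fuel≡length
  where
  fuel≡length : ∀ {p} → p ∈ choices (y ∷ ys) → joinᶠ (length ys) φ x p ≡ join φ x p
  fuel≡length p∈ rewrite ℕ.suc-injective (proj₂ (proj₂ (∈-choices⁻ p∈))) = refl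

#nc-isolated : ∀ φ z r → (∀ {y} → y ∈ r → φ (segment (z , y)) ≡ false) → #nc φ (z ∷ r) ≡ 0
#nc-isolated φ z r unjoinable = trans (#nc-∷ φ z r) (∑-≡0 (choices r) noPartner)
  where
  noPartner : ∀ {p} → p ∈ choices r → join φ z p ≡ 0
  noPartner {y , rest} p∈ rewrite unjoinable (proj₁ (∈-choices⁻ p∈)) = refl

join-isolating : ∀ φ x y z r → (∀ {w} → w ∈ r → avoid (segment (x , y)) φ (segment (z , w)) ≡ false) →
                 join φ x (y , z ∷ r) ≡ 0
join-isolating φ x y z r isolated = if-zero (φ (segment (x , y))) (#nc-isolated (avoid (segment (x , y)) φ) z r isolated)

Agree : (Seg → Bool) → (Seg → Bool) → List Pt → Set
Agree φ ψ xs = ∀ {u v} → u ∈ xs → v ∈ xs → φ (segment (u , v)) ≡ ψ (segment (u , v))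

Agree-avoid : ∀ s φ ψ {xs} → Agree φ ψ xs → Agree (avoid s φ) (avoid s ψ) xs
Agree-avoid s φ ψ φ≡ψ u∈ v∈ = cong (_∧ _) (φ≡ψ u∈ v∈)

Agree-⊆ : ∀ φ ψ {xs ys} → ys ⊆ xs → Agree φ ψ xs → Agree φ ψ ys
Agree-⊆ φ ψ ys⊆xs φ≡ψ u∈ v∈ = φ≡ψ (ys⊆xs u∈) (ys⊆xs v∈)

#ncᶠ-cong : ∀ m {φ ψ} xs → Agree φ ψ xs → #ncᶠ m φ xs ≡ #ncᶠ m ψ xs
#ncᶠ-cong zero          xs       φ≡ψ = refl
#ncᶠ-cong (suc zero)    xs       φ≡ψ = refl
#ncᶠ-cong (suc (suc m)) []       φ≡ψ = refl
#ncᶠ-cong (suc (suc m)) {φ} {ψ} (x ∷ xs) φ≡ψ = ∑-cong-∈ (choices xs) joinᶠ-cong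
  where
  joinᶠ-cong : ∀ {p} → p ∈ choices xs → joinᶠ m φ x p ≡ joinᶠ m ψ x p
  joinᶠ-cong {y , rest} p∈ with ∈-choices⁻ p∈
  ... | y∈ , rest⊆ , _ =
    cong₂ (λ b n → if b then n else 0) (φ≡ψ (here refl) (there y∈))
      (#ncᶠ-cong m rest (Agree-⊆ (avoid s φ) (avoid s ψ) (there ∘ rest⊆) (Agree-avoid s φ ψ φ≡ψ)))
    where s = segment (x , y)

#nc-cong : ∀ {φ ψ} xs → Agree φ ψ xs → #nc φ xs ≡ #nc ψ xs
#nc-cong xs = #ncᶠ-cong (length xs) xs

-- Two classes of points that do not interact

Unjoinable : (Pt → Set) → (Seg → Bool) → List Pt → Set
Unjoinable P φ xs = ∀ {u v} → u ∈ xs → v ∈ xs → P u → ¬ P v →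
  φ (segment (u , v)) ≡ false × φ (segment (v , u)) ≡ false

Noninterfering : (Pt → Set) → List Pt → Set
Noninterfering P xs = ∀ {u₁ u₂ v₁ v₂} → u₁ ∈ xs → u₂ ∈ xs → v₁ ∈ xs → v₂ ∈ xs →
  P u₁ → P u₂ → ¬ P v₁ → ¬ P v₂ →
  meet (segment (u₁ , u₂)) (segment (v₁ , v₂)) ≡ false × meet (segment (v₁ , v₂)) (segment (u₁ , u₂)) ≡ false

Unjoinable-⊆ : ∀ P φ {xs ys} → ys ⊆ xs → Unjoinable P φ xs → Unjoinable P φ ys
Unjoinable-⊆ P φ ys⊆xs unj u∈ v∈ = unj (ys⊆xs u∈) (ys⊆xs v∈)

Unjoinable-avoid : ∀ P φ s {xs} → Unjoinable P φ xs → Unjoinable P (avoid s φ) xs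
Unjoinable-avoid P φ s unj u∈ v∈ pu ¬pv with unj u∈ v∈ pu ¬pv
... | uv , vu = avoid-forbidden s φ uv , avoid-forbidden s φ vu

Noninterfering-⊆ : ∀ P {xs ys} → ys ⊆ xs → Noninterfering P xs → Noninterfering P ys
Noninterfering-⊆ P ys⊆xs ni u₁∈ u₂∈ v₁∈ v₂∈ = ni (ys⊆xs u₁∈) (ys⊆xs u₂∈) (ys⊆xs v₁∈) (ys⊆xs v₂∈)

module _ {P : Pt → Set} (P? : Decidable P) where

  Unjoinable-∁ : ∀ φ {xs} → Unjoinable P φ xs → Unjoinable (∁ P) φ xs
  Unjoinable-∁ φ unj u∈ v∈ ¬pu ¬¬pv with unj v∈ u∈ (decidable-stable (P? _) ¬¬pv) ¬pu
  ... | vu , uv = uv , vu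

  Noninterfering-∁ : ∀ {xs} → Noninterfering P xs → Noninterfering (∁ P) xs
  Noninterfering-∁ ni u₁∈ u₂∈ v₁∈ v₂∈ ¬pu₁ ¬pu₂ ¬¬pv₁ ¬¬pv₂
    with ni v₁∈ v₂∈ u₁∈ u₂∈ (decidable-stable (P? _) ¬¬pv₁) (decidable-stable (P? _) ¬¬pv₂) ¬pu₁ ¬pu₂
  ... | vu , uv = uv , vu

  filter-∁∁ : ∀ xs → filter (∁? (∁? P?)) xs ≡ filter P? xs
  filter-∁∁ = filter-≐ (∁? (∁? P?)) P? (decidable-stable (P? _) , λ p ¬p → ¬p p)

#nc-otherClass : ∀ {P} (P? : Decidable P) φ {x xs y rest} → (y , rest) ∈ choices xs → P x → P y →
                 Noninterfering P (x ∷ xs) →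
                 #nc (avoid (segment (x , y)) φ) (filter (∁? P?) rest) ≡ #nc φ (filter (∁? P?) xs)
#nc-otherClass P? φ {x} {xs} {y} yr∈ px py ni =
  trans (cong (#nc (avoid s φ)) (filter-choices-rest (∁? P?) yr∈ (λ ¬py → ¬py py)))
        (#nc-cong (filter (∁? P?) xs) avoid≗φ)
  where
  s = segment (x , y)
  avoid≗φ : Agree (avoid s φ) φ (filter (∁? P?) xs)
  avoid≗φ u∈ v∈ with ∈-filter⁻ (∁? P?) u∈ | ∈-filter⁻ (∁? P?) v∈
  ... | u∈xs , ¬pu | v∈xs , ¬pv =
    avoid-disjoint s φ (proj₁ (ni (here refl) (there (proj₁ (∈-choices⁻ yr∈))) (there u∈xs) (there v∈xs) px py ¬pu ¬pv))

mutual
  #nc-split-≤ : ∀ {P} (P? : Decidable P) F φ xs → length xs ≤ F → Unjoinable P φ xs → Noninterfering P xs →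
                #nc φ xs ≡ #nc φ (filter P? xs) * #nc φ (filter (∁? P?) xs)
  #nc-split-≤ P? F       φ []       _         _   _  = refl
  #nc-split-≤ P? (suc F) φ (x ∷ xs) (s≤s len) unj ni with P? x
  ... | yes px = #nc-split-head P? F φ x xs px len unj ni
  ... | no ¬px = begin
    #nc φ (x ∷ xs)
      ≡⟨ #nc-split-head (∁? P?) F φ x xs ¬px len (Unjoinable-∁ P? φ unj) (Noninterfering-∁ P? ni) ⟩
    #nc φ (x ∷ filter (∁? P?) xs) * #nc φ (filter (∁? (∁? P?)) xs)
      ≡⟨ cong (λ l → #nc φ (x ∷ filter (∁? P?) xs) * #nc φ l) (filter-∁∁ P? xs) ⟩
    #nc φ (x ∷ filter (∁? P?) xs) * #nc φ (filter P? xs)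
      ≡⟨ ℕ.*-comm _ (#nc φ (filter P? xs)) ⟩
    #nc φ (filter P? xs) * #nc φ (x ∷ filter (∁? P?) xs) ∎
    where open ≡-Reasoning

  -- The partner of x lies in its class, and drawing that segment leaves
  -- the other class untouched.
  #nc-split-head : ∀ {P} (P? : Decidable P) F φ x xs → P x → length xs ≤ F →
                   Unjoinable P φ (x ∷ xs) → Noninterfering P (x ∷ xs) →
                   #nc φ (x ∷ xs) ≡ #nc φ (x ∷ filter P? xs) * #nc φ (filter (∁? P?) xs)
  #nc-split-head {P} P? F φ x xs px len unj ni = begin
    #nc φ (x ∷ xs)
      ≡⟨ #nc-∷ φ x xs ⟩
    ∑ (join φ x) (choices xs)
      ≡⟨ ∑-cong-∈ (choices xs) partnerInP ⟩
    ∑ (λ p → if does (P? (proj₁ p)) then join φ x p else 0) (choices xs)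
      ≡⟨ ∑-filter (P? ∘ proj₁) (join φ x) (choices xs) ⟨
    ∑ (join φ x) withPartnerInP
      ≡⟨ ∑-cong-∈ withPartnerInP joinFactors ⟩
    ∑ (λ p → join φ x (map₂ (filter P?) p) * C) withPartnerInP
      ≡⟨ ∑-distribʳ-* (join φ x ∘ map₂ (filter P?)) C withPartnerInP ⟩
    ∑ (join φ x ∘ map₂ (filter P?)) withPartnerInP * C
      ≡⟨ cong (_* C) (∑-map (join φ x) (map₂ (filter P?)) withPartnerInP) ⟨
    ∑ (join φ x) (map (map₂ (filter P?)) withPartnerInP) * C
      ≡⟨ cong (λ l → ∑ (join φ x) l * C) (choices-filter P? xs) ⟨
    ∑ (join φ x) (choices (filter P? xs)) * C
      ≡⟨ cong (_* C) (#nc-∷ φ x (filter P? xs)) ⟨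
    #nc φ (x ∷ filter P? xs) * C ∎
    where
    open ≡-Reasoning
    C = #nc φ (filter (∁? P?) xs)
    withPartnerInP = filter (P? ∘ proj₁) (choices xs)

    partnerInP : ∀ {p} → p ∈ choices xs → join φ x p ≡ (if does (P? (proj₁ p)) then join φ x p else 0)
    partnerInP {y , rest} p∈ with P? y
    ... | yes _  = refl
    ... | no ¬py rewrite proj₁ (unj (here refl) (there (proj₁ (∈-choices⁻ p∈))) px ¬py) = refl

    joinFactors : ∀ {p} → p ∈ withPartnerInP → join φ x p ≡ join φ x (map₂ (filter P?) p) * C
    joinFactors {y , rest} p∈ with ∈-filter⁻ (P? ∘ proj₁) p∈
    ... | yr∈ , py with ∈-choices⁻ yr∈
    ...   | _ , rest⊆ , len-rest =
      trans (cong (if φ s then_else 0) restFactors) (sym (if-* (φ s) (#nc (avoid s φ) (filter P? rest)) C))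
      where
      s = segment (x , y)
      rest⊆x∷xs : rest ⊆ x ∷ xs
      rest⊆x∷xs = there ∘ rest⊆
      restFactors : #nc (avoid s φ) rest ≡ #nc (avoid s φ) (filter P? rest) * C
      restFactors =
        trans (#nc-split-≤ P? F (avoid s φ) rest (ℕ.≤-trans (ℕ.n≤1+n _) (ℕ.≤-trans (ℕ.≤-reflexive len-rest) len))
                 (Unjoinable-⊆ P (avoid s φ) rest⊆x∷xs (Unjoinable-avoid P φ s unj)) (Noninterfering-⊆ P rest⊆x∷xs ni))
              (cong (#nc (avoid s φ) (filter P? rest) *_) (#nc-otherClass P? φ yr∈ px py ni))

#nc-split : ∀ {P} (P? : Decidable P) φ xs → Unjoinable P φ xs → Noninterfering P xs →
            #nc φ xs ≡ #nc φ (filter P? xs) * #nc φ (filter (∁? P?) xs)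
#nc-split P? φ xs = #nc-split-≤ P? (length xs) φ xs ℕ.≤-refl

reflects-true : ∀ {A : Set} {b} → Reflects A b → A → b ≡ true
reflects-true (ofʸ _)  _ = refl
reflects-true (ofⁿ ¬a) a = ⊥-elim (¬a a)

reflects-false : ∀ {A : Set} {b} → Reflects A b → ¬ A → b ≡ false
reflects-false (ofʸ a) ¬a = ⊥-elim (¬a a)
reflects-false (ofⁿ _) _  = refl

≤ᵇ-true : ∀ {m n} → m ≤ n → (m ≤ᵇ n) ≡ true
≤ᵇ-true {m} {n} = reflects-true (ℕ.≤ᵇ-reflects-≤ m n)

≤ᵇ-false : ∀ {m n} → n < m → (m ≤ᵇ n) ≡ false
≤ᵇ-false {m} {n} n<m = reflects-false (ℕ.≤ᵇ-reflects-≤ m n) (ℕ.<⇒≱ n<m)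

<ᵇ-true : ∀ {m n} → m < n → (m <ᵇ n) ≡ true
<ᵇ-true {m} {n} = reflects-true (ℕ.<ᵇ-reflects-< m n)

<ᵇ-false : ∀ {m n} → n ≤ m → (m <ᵇ n) ≡ false
<ᵇ-false {m} {n} n≤m = reflects-false (ℕ.<ᵇ-reflects-< m n) (ℕ.≤⇒≯ n≤m)

≡ᵇ-false : ∀ {m n} → m ≢ n → (m ≡ᵇ n) ≡ false
≡ᵇ-false {m} {n} = reflects-false (fromEquivalence (ℕ.≡ᵇ⇒≡ m n) (ℕ.≡⇒≡ᵇ m n))

min≡⊓ : ∀ a b → min a b ≡ a ⊓ b
min≡⊓ a b with a ≤ᵇ b in eq
... | true  = sym (ℕ.m≤n⇒m⊓n≡m (ℕ.≤ᵇ⇒≤ a b (subst T (sym eq) _)))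
... | false = sym (ℕ.m≥n⇒m⊓n≡n (ℕ.<⇒≤ (ℕ.≰⇒> (λ a≤b → subst T eq (ℕ.≤⇒≤ᵇ a≤b)))))

max≡⊔ : ∀ a b → max a b ≡ a ⊔ b
max≡⊔ a b with a ≤ᵇ b in eq
... | true  = sym (ℕ.m≤n⇒m⊔n≡n (ℕ.≤ᵇ⇒≤ a b (subst T (sym eq) _)))
... | false = sym (ℕ.m≥n⇒m⊔n≡m (ℕ.<⇒≤ (ℕ.≰⇒> (λ a≤b → subst T eq (ℕ.≤⇒≤ᵇ a≤b)))))

min≤ˡ : ∀ a b → min a b ≤ a
min≤ˡ a b = subst (_≤ a) (sym (min≡⊓ a b)) (ℕ.m⊓n≤m a b)

min≤ʳ : ∀ a b → min a b ≤ b
min≤ʳ a b = subst (_≤ b) (sym (min≡⊓ a b)) (ℕ.m⊓n≤n a b)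

≤maxˡ : ∀ a b → a ≤ max a b
≤maxˡ a b = subst (a ≤_) (sym (max≡⊔ a b)) (ℕ.m≤m⊔n a b)

≤maxʳ : ∀ a b → b ≤ max a b
≤maxʳ a b = subst (b ≤_) (sym (max≡⊔ a b)) (ℕ.m≤n⊔m a b)

≤-min : ∀ {c} a b → c ≤ a → c ≤ b → c ≤ min a b
≤-min a b c≤a c≤b = subst (_ ≤_) (sym (min≡⊓ a b)) (ℕ.⊓-glb c≤a c≤b)

<-min : ∀ {c} a b → c < a → c < b → c < min a b
<-min a b c<a c<b = subst (_ <_) (sym (min≡⊓ a b)) (ℕ.⊓-glb c<a c<b)

max-< : ∀ {c} a b → a < c → b < c → max a b < c
max-< a b a<c b<c = subst (_< _) (sym (max≡⊔ a b)) (ℕ.⊔-lub a<c b<c)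

overlap-true : ∀ a b c d → c ≤ b → a ≤ d → (c ≤ᵇ b) ∧ (a ≤ᵇ d) ≡ true
overlap-true a b c d c≤b a≤d rewrite ≤ᵇ-true c≤b | ≤ᵇ-true a≤d = refl

overlap-before : ∀ a b c d → b < c → (c ≤ᵇ b) ∧ (a ≤ᵇ d) ≡ false
overlap-before a b c d b<c rewrite ≤ᵇ-false b<c = refl

overlap-after : ∀ a b c d → d < a → (c ≤ᵇ b) ∧ (a ≤ᵇ d) ≡ false
overlap-after a b c d d<a rewrite ≤ᵇ-false d<a = Bool.∧-zeroʳ (c ≤ᵇ b)

through-true : ∀ a b x → a ≤ x → x ≤ b → (a ≤ᵇ x) ∧ (x ≤ᵇ b) ≡ true
through-true a b x a≤x x≤b rewrite ≤ᵇ-true a≤x | ≤ᵇ-true x≤b = refl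

through-before : ∀ a b x → x < a → (a ≤ᵇ x) ∧ (x ≤ᵇ b) ≡ false
through-before a b x x<a rewrite ≤ᵇ-false x<a = refl

through-after : ∀ a b x → b < x → (a ≤ᵇ x) ∧ (x ≤ᵇ b) ≡ false
through-after a b x b<x rewrite ≤ᵇ-false b<x = Bool.∧-zeroʳ (a ≤ᵇ x)

crossing-true : ∀ {i j i′ j′} → i < i′ → j′ < j → meet (cross i j) (cross i′ j′) ≡ true
crossing-true i<i′ j′<j
  rewrite ≡ᵇ-false (ℕ.<⇒≢ i<i′) | ≡ᵇ-false (ℕ.>⇒≢ j′<j) | <ᵇ-true i<i′ | <ᵇ-false (ℕ.<⇒≤ j′<j) = refl

parallel-false : ∀ {i j i′ j′} → i < i′ → j < j′ → meet (cross i j) (cross i′ j′) ≡ false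
parallel-false i<i′ j<j′
  rewrite ≡ᵇ-false (ℕ.<⇒≢ i<i′) | ≡ᵇ-false (ℕ.<⇒≢ j<j′) | <ᵇ-true i<i′ | <ᵇ-true j<j′ = refl

run : (ℕ → Pt) → ℕ → ℕ → List Pt
run pt p zero    = []
run pt p (suc k) = pt p ∷ run pt (suc p) k

topsFrom botsFrom : ℕ → ℕ → List Pt
topsFrom = run top
botsFrom = run bot

applyUpTo≡run : ∀ pt (f : ℕ → Pt) p k → (∀ i → f i ≡ pt (p + i)) → applyUpTo f k ≡ run pt p k
applyUpTo≡run pt f p zero    f≡ = refl
applyUpTo≡run pt f p (suc k) f≡ =
  cong₂ _∷_ (trans (f≡ 0) (cong pt (ℕ.+-identityʳ p)))
            (applyUpTo≡run pt (f ∘ suc) (suc p) k (λ i → trans (f≡ (suc i)) (cong pt (ℕ.+-suc p i))))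

points≡ : ∀ k n → points k n ≡ topsFrom 0 k ++ botsFrom 0 n
points≡ k n = cong₂ _++_ (trans (map-applyUpTo (λ i → i) top k) (applyUpTo≡run top top 0 k (λ _ → refl)))
                         (trans (map-applyUpTo (λ i → i) bot n) (applyUpTo≡run bot bot 0 n (λ _ → refl)))

∈-run⁻ : ∀ {pt p k u} → u ∈ run pt p k → ∃ λ i → u ≡ pt i × p ≤ i × i < p + k
∈-run⁻ {p = p} {suc k} (here refl) = p , refl , ℕ.≤-refl , ℕ.m<m+n p (s≤s z≤n)
∈-run⁻ {p = p} {suc k} (there u∈) with ∈-run⁻ u∈
... | i , refl , p<i , i<p+k = i , refl , ℕ.<⇒≤ p<i , subst (i <_) (sym (ℕ.+-suc p k)) i<p+k

AllJoinable : (Seg → Bool) → List Pt → Set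
AllJoinable φ xs = ∀ {u v} → u ∈ xs → v ∈ xs → φ (segment (u , v)) ≡ true

botsFrom-++-∷ : ∀ q t c (r : List Pt) → c ≡ q + t → botsFrom q t ++ (bot c ∷ r) ≡ botsFrom q (suc t) ++ r
botsFrom-++-∷ q zero    c r c≡q+t = cong (λ b → bot b ∷ r) (trans c≡q+t (ℕ.+-identityʳ q))
botsFrom-++-∷ q (suc t) c r c≡q+t = cong (bot q ∷_) (botsFrom-++-∷ (suc q) t c r (trans c≡q+t (ℕ.+-suc q t)))

OnStrip : ℕ → ℕ → Pt → Set
OnStrip p q (top i) = p ≤ i
OnStrip p q (bot b) = q ≤ b

∈-strip⁻ : ∀ p k q n {u} → u ∈ topsFrom p k ++ botsFrom q n → OnStrip p q u
∈-strip⁻ p k q n u∈ with ∈-++⁻ (topsFrom p k) u∈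
... | inj₁ u∈tops with ∈-run⁻ u∈tops
...   | i , refl , p≤i , _ = p≤i
∈-strip⁻ p k q n u∈ | inj₂ u∈bots with ∈-run⁻ u∈bots
...   | b , refl , q≤b , _ = q≤b

even : ℕ → Bool
even zero          = true
even (suc zero)    = false
even (suc (suc n)) = even n

-- The first point must be joined to its neighbour: a longer segment would
-- enclose the neighbour, which could then be joined to nothing.
#nc-dominoes : ∀ q t φ → AllJoinable φ (botsFrom q t) → #nc φ (botsFrom q t) ≡ (if even t then 1 else 0)
#nc-dominoes q zero          φ _        = refl
#nc-dominoes q (suc zero)    φ _        = refl
#nc-dominoes q (suc (suc t)) φ joinable = begin
  #nc φ (bot q ∷ bot (suc q) ∷ R)
    ≡⟨ #nc-∷ φ (bot q) (bot (suc q) ∷ R) ⟩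
  join φ (bot q) (bot (suc q) , R) + ∑ (join φ (bot q)) (map (map₂ (bot (suc q) ∷_)) (choices R))
    ≡⟨ cong₂ _+_ withNeighbour (∑-≡0 (map (map₂ (bot (suc q) ∷_)) (choices R)) beyondNeighbour) ⟩
  (if even t then 1 else 0) + 0
    ≡⟨ ℕ.+-identityʳ _ ⟩
  (if even t then 1 else 0) ∎
  where
  open ≡-Reasoning
  R = botsFrom (suc (suc q)) t
  s₀ = segment (bot q , bot (suc q))

  stillJoinable : AllJoinable (avoid s₀ φ) R
  stillJoinable u∈ v∈ with ∈-run⁻ u∈ | ∈-run⁻ v∈
  ... | b , refl , q+2≤b , _ | b′ , refl , q+2≤b′ , _ =
    trans (avoid-disjoint s₀ φ (overlap-before (min q (suc q)) (max q (suc q)) (min b b′) (max b b′)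
            (ℕ.<-≤-trans (max-< q (suc q) (ℕ.m<n⇒m<1+n ℕ.≤-refl) ℕ.≤-refl) (≤-min b b′ q+2≤b q+2≤b′))))
          (joinable (there (there u∈)) (there (there v∈)))

  withNeighbour : join φ (bot q) (bot (suc q) , R) ≡ (if even t then 1 else 0)
  withNeighbour rewrite joinable (here refl) (there (here refl)) = #nc-dominoes (suc (suc q)) t (avoid s₀ φ) stillJoinable

  beyondNeighbour : ∀ {p} → p ∈ map (map₂ (bot (suc q) ∷_)) (choices R) → join φ (bot q) p ≡ 0
  beyondNeighbour p∈ with ∈-map⁻ (map₂ (bot (suc q) ∷_)) p∈
  ... | (y , r) , yr∈ , refl with ∈-choices⁻ yr∈
  ...   | y∈ , r⊆ , _ with ∈-run⁻ y∈
  ...     | j , refl , q+2≤j , _ = join-isolating φ (bot q) (bot j) (bot (suc q)) r isolated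
    where
    isolated : ∀ {w} → w ∈ r → avoid (segment (bot q , bot j)) φ (segment (bot (suc q) , w)) ≡ false
    isolated w∈ with ∈-run⁻ (r⊆ w∈)
    ... | b , refl , q+2≤b , _ = avoid-meeting (segment (bot q , bot j)) φ
      (overlap-true (min q j) (max q j) (min (suc q) b) (max (suc q) b)
        (ℕ.≤-trans (min≤ˡ (suc q) b) (ℕ.≤-trans (ℕ.<⇒≤ q+2≤j) (≤maxʳ q j)))
        (ℕ.≤-trans (min≤ˡ q j) (ℕ.≤-trans (ℕ.n≤1+n q) (≤maxˡ (suc q) b))))

-- A top partner of top p can only be top (p + 1), as in #nc-dominoes.
module _ (φ : Seg → Bool) (p k q n : ℕ) (joinable : AllJoinable φ (topsFrom p (2 + k) ++ botsFrom q n)) where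

  private
    s₀ = segment (top p , top (suc p))
    rest = topsFrom (2 + p) k ++ botsFrom q n

    s₀<p+2 : max p (suc p) < 2 + p
    s₀<p+2 = max-< p (suc p) (ℕ.m<n⇒m<1+n ℕ.≤-refl) ℕ.≤-refl

    apart : ∀ u v → OnStrip (2 + p) q u → OnStrip (2 + p) q v → meet s₀ (segment (u , v)) ≡ false
    apart (top i) (top i′) p+2≤i p+2≤i′ =
      overlap-before (min p (suc p)) (max p (suc p)) (min i i′) (max i i′)
        (ℕ.<-≤-trans s₀<p+2 (≤-min i i′ p+2≤i p+2≤i′))
    apart (top i) (bot b)  p+2≤i _ = through-after (min p (suc p)) (max p (suc p)) i (ℕ.<-≤-trans s₀<p+2 p+2≤i)
    apart (bot b) (top i)  _ p+2≤i = through-after (min p (suc p)) (max p (suc p)) i (ℕ.<-≤-trans s₀<p+2 p+2≤i)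
    apart (bot b) (bot b′) _ _     = refl

    covered : ∀ {j} w → suc p < j → OnStrip (2 + p) q w → meet (segment (top p , top j)) (segment (top (suc p) , w)) ≡ true
    covered {j} (top i) p+1<j p+2≤i =
      overlap-true (min p j) (max p j) (min (suc p) i) (max (suc p) i)
        (ℕ.≤-trans (min≤ˡ (suc p) i) (ℕ.≤-trans (ℕ.<⇒≤ p+1<j) (≤maxʳ p j)))
        (ℕ.≤-trans (min≤ˡ p j) (ℕ.≤-trans (ℕ.n≤1+n p) (≤maxˡ (suc p) i)))
    covered {j} (bot b) p+1<j _ =
      through-true (min p j) (max p j) (suc p)
        (ℕ.≤-trans (min≤ˡ p j) (ℕ.n≤1+n p)) (ℕ.≤-trans (ℕ.<⇒≤ p+1<j) (≤maxʳ p j))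

  AllJoinable-topNeighbour : AllJoinable (avoid s₀ φ) rest
  AllJoinable-topNeighbour {u} {v} u∈ v∈ =
    trans (avoid-disjoint s₀ φ (apart u v (∈-strip⁻ (2 + p) k q n u∈) (∈-strip⁻ (2 + p) k q n v∈)))
          (joinable (there (there u∈)) (there (there v∈)))

  ∑join-topPartner : ∑ (join φ (top p)) (map (map₂ (_++ botsFrom q n)) (choices (topsFrom (suc p) (suc k))))
                     ≡ #nc (avoid s₀ φ) rest
  ∑join-topPartner = begin
    join φ (top p) (top (suc p) , rest) + ∑ (join φ (top p)) (map addBots (map (map₂ (top (suc p) ∷_)) (choices tops)))
      ≡⟨ cong₂ _+_ withNeighbour
           (trans (∑-map (join φ (top p)) addBots (map (map₂ (top (suc p) ∷_)) (choices tops)))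
           (trans (∑-map (join φ (top p) ∘ addBots) (map₂ (top (suc p) ∷_)) (choices tops))
                  (∑-≡0 (choices tops) beyondNeighbour))) ⟩
    #nc (avoid s₀ φ) rest + 0
      ≡⟨ ℕ.+-identityʳ _ ⟩
    #nc (avoid s₀ φ) rest ∎
    where
    open ≡-Reasoning
    tops = topsFrom (2 + p) k
    addBots = map₂ (_++ botsFrom q n)
    withNeighbour : join φ (top p) (top (suc p) , rest) ≡ #nc (avoid s₀ φ) rest
    withNeighbour rewrite joinable (here refl) (there (here refl)) = refl
    beyondNeighbour : ∀ {pr} → pr ∈ choices tops → join φ (top p) (proj₁ pr , top (suc p) ∷ (proj₂ pr ++ botsFrom q n)) ≡ 0
    beyondNeighbour {y , r} yr∈ with ∈-choices⁻ yr∈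
    ... | y∈ , r⊆ , _ with ∈-run⁻ y∈
    ...   | j , refl , p+2≤j , _ = join-isolating φ (top p) (top j) (top (suc p)) (r ++ botsFrom q n) λ {w} w∈ →
      avoid-meeting (segment (top p , top j)) φ (covered w p+2≤j (∈-strip⁻ (2 + p) k q n (++⁺ˡ (botsFrom q n) r⊆ w∈)))

BotLeftOf : ℕ → Pt → Set
BotLeftOf c (top _) = ⊥
BotLeftOf c (bot b) = b < c

botLeftOf? : ∀ c → Decidable (BotLeftOf c)
botLeftOf? c (top _) = no (λ ())
botLeftOf? c (bot b) = b <? c

AwayFrom : ℕ → ℕ → Pt → Set
AwayFrom p c (top i) = p < i
AwayFrom p c (bot b) = b < c ⊎ c < b

module _ {p c : ℕ} where

  cross-cuts : ∀ u v → BotLeftOf c u → AwayFrom p c v → ¬ BotLeftOf c v →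
               meet (cross p c) (segment (u , v)) ≡ true × meet (cross p c) (segment (v , u)) ≡ true
  cross-cuts (bot b) (top i) b<c p<i _ = crossing-true p<i b<c , crossing-true p<i b<c
  cross-cuts (bot b) (bot b′) b<c (inj₁ b′<c) b′≮c = ⊥-elim (b′≮c b′<c)
  cross-cuts (bot b) (bot b′) b<c (inj₂ c<b′) _ =
    through-true (min b b′) (max b b′) c
      (ℕ.≤-trans (min≤ˡ b b′) (ℕ.<⇒≤ b<c)) (ℕ.≤-trans (ℕ.<⇒≤ c<b′) (≤maxʳ b b′)) ,
    through-true (min b′ b) (max b′ b) c
      (ℕ.≤-trans (min≤ʳ b′ b) (ℕ.<⇒≤ b<c)) (ℕ.≤-trans (ℕ.<⇒≤ c<b′) (≤maxˡ b′ b))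

  misses-left : ∀ b b′ → b < c → b′ < c → meet (cross p c) (segment (bot b , bot b′)) ≡ false
  misses-left b b′ b<c b′<c = through-after (min b b′) (max b b′) c (max-< b b′ b<c b′<c)

  misses-right : ∀ u v → OnStrip (suc p) (suc c) u → OnStrip (suc p) (suc c) v → meet (cross p c) (segment (u , v)) ≡ false
  misses-right (top i) (top i′) p<i p<i′ = through-before (min i i′) (max i i′) p (<-min i i′ p<i p<i′)
  misses-right (top i) (bot b)  p<i c<b  = parallel-false p<i c<b
  misses-right (bot b) (top i)  c<b p<i  = parallel-false p<i c<b
  misses-right (bot b) (bot b′) c<b c<b′ = through-before (min b b′) (max b b′) c (<-min b b′ c<b c<b′)

  left-right-apart : ∀ u₁ u₂ v₁ v₂ → BotLeftOf c u₁ → BotLeftOf c u₂ →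
    AwayFrom p c v₁ → AwayFrom p c v₂ → ¬ BotLeftOf c v₁ → ¬ BotLeftOf c v₂ →
    meet (segment (u₁ , u₂)) (segment (v₁ , v₂)) ≡ false × meet (segment (v₁ , v₂)) (segment (u₁ , u₂)) ≡ false
  left-right-apart (bot b₁) (bot b₂) v₁ v₂ b₁<c b₂<c v₁-away v₂-away v₁∉ v₂∉ =
    go v₁ v₂ (right v₁ v₁-away v₁∉) (right v₂ v₂-away v₂∉)
    where
    hi<c : max b₁ b₂ < c
    hi<c = max-< b₁ b₂ b₁<c b₂<c
    right : ∀ v → AwayFrom p c v → ¬ BotLeftOf c v → OnStrip (suc p) (suc c) v
    right (top i) p<i _ = p<i
    right (bot b) (inj₁ b<c) b≮c = ⊥-elim (b≮c b<c)
    right (bot b) (inj₂ c<b) _   = c<b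
    lo = min b₁ b₂
    hi = max b₁ b₂
    go : ∀ v₁ v₂ → OnStrip (suc p) (suc c) v₁ → OnStrip (suc p) (suc c) v₂ →
      meet (onBot lo hi) (segment (v₁ , v₂)) ≡ false × meet (segment (v₁ , v₂)) (onBot lo hi) ≡ false
    go (top i) (top i′) _ _ = refl , refl
    go (top i) (bot b)  _ c<b = through-after lo hi b (ℕ.<-trans hi<c c<b) , through-after lo hi b (ℕ.<-trans hi<c c<b)
    go (bot b) (top i)  c<b _ = through-after lo hi b (ℕ.<-trans hi<c c<b) , through-after lo hi b (ℕ.<-trans hi<c c<b)
    go (bot b) (bot b′) c<b c<b′ =
      overlap-before lo hi (min b b′) (max b b′) hi<min , overlap-after (min b b′) (max b b′) lo hi hi<min
      where hi<min = ℕ.<-≤-trans hi<c (ℕ.<⇒≤ (<-min b b′ c<b c<b′))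

-- When top p is joined to bot c, the t bottom points left of c can only be
-- joined among themselves and do not interact with the other points.
module _ (φ : Seg → Bool) (p k q t c n : ℕ) (c≡q+t : c ≡ q + t)
         (joinable : AllJoinable φ (top p ∷ topsFrom (suc p) k ++ (botsFrom q t ++ botsFrom c (suc n)))) where

  private
    s = cross p c
    tops  = topsFrom (suc p) k
    left  = botsFrom q t
    right = botsFrom (suc c) n
    rest  = tops ++ (left ++ right)

    rest⊆ : rest ⊆ top p ∷ tops ++ (left ++ botsFrom c (suc n))
    rest⊆ = there ∘ ++⁺ʳ tops (++⁺ʳ left (xs⊆x∷xs right (bot c)))

    left⊆rest : left ⊆ rest
    left⊆rest = xs⊆ys++xs (left ++ right) tops ∘ xs⊆xs++ys left right

    outer⊆rest : tops ++ right ⊆ rest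
    outer⊆rest = ++⁺ʳ tops (xs⊆ys++xs right left)

    left-of-c : ∀ {u} → u ∈ left → ∃ λ b → u ≡ bot b × b < c
    left-of-c u∈ with ∈-run⁻ u∈
    ... | b , refl , _ , b<q+t = b , refl , subst (b <_) (sym c≡q+t) b<q+t

    away : ∀ {u} → u ∈ rest → AwayFrom p c u
    away u∈ with ∈-++⁻ tops u∈
    ... | inj₁ u∈tops with ∈-run⁻ u∈tops
    ...   | i , refl , p<i , _ = p<i
    away u∈ | inj₂ u∈bots with ∈-++⁻ left u∈bots
    ...   | inj₁ u∈left with left-of-c u∈left
    ...     | b , refl , b<c = inj₁ b<c
    away u∈ | inj₂ u∈bots | inj₂ u∈right with ∈-run⁻ u∈right
    ...     | b , refl , c<b , _ = inj₂ c<b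

    outer : ∀ {u} → u ∈ tops ++ right → OnStrip (suc p) (suc c) u
    outer = ∈-strip⁻ (suc p) k (suc c) n

    unjoinable : Unjoinable (BotLeftOf c) (avoid s φ) rest
    unjoinable {u} {v} u∈ v∈ pu ¬pv with cross-cuts u v pu (away v∈) ¬pv
    ... | uv , vu = avoid-meeting s φ uv , avoid-meeting s φ vu

    noninterfering : Noninterfering (BotLeftOf c) rest
    noninterfering {u₁} {u₂} {v₁} {v₂} _ _ v₁∈ v₂∈ pu₁ pu₂ ¬pv₁ ¬pv₂ =
      left-right-apart u₁ u₂ v₁ v₂ pu₁ pu₂ (away v₁∈) (away v₂∈) ¬pv₁ ¬pv₂

    not-left : ∀ u → OnStrip (suc p) (suc c) u → ¬ BotLeftOf c u
    not-left (top i) _   ()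
    not-left (bot b) c<b b<c = ℕ.<-asym b<c c<b

    tops-not-left : All (∁ (BotLeftOf c)) tops
    tops-not-left = tabulate λ {u} u∈ → not-left u (outer (∈-++⁺ˡ u∈))

    right-not-left : All (∁ (BotLeftOf c)) right
    right-not-left = tabulate λ {u} u∈ → not-left u (outer (∈-++⁺ʳ tops u∈))

    left-is-left : All (BotLeftOf c) left
    left-is-left = tabulate λ u∈ → let b , u≡bot , b<c = left-of-c u∈ in subst (BotLeftOf c) (sym u≡bot) b<c

    filter-left : filter (botLeftOf? c) rest ≡ left
    filter-left = begin
      filter P? (tops ++ (left ++ right))              ≡⟨ filter-++ P? tops (left ++ right) ⟩
      filter P? tops ++ filter P? (left ++ right)      ≡⟨ cong₂ _++_ (filter-none P? tops-not-left) (filter-++ P? left right) ⟩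
      filter P? left ++ filter P? right                ≡⟨ cong₂ _++_ (filter-all P? left-is-left) (filter-none P? right-not-left) ⟩
      left ++ []                                       ≡⟨ ++-identityʳ left ⟩
      left                                             ∎
      where
      open ≡-Reasoning
      P? = botLeftOf? c

    filter-outer : filter (∁? (botLeftOf? c)) rest ≡ tops ++ right
    filter-outer = begin
      filter ∁P? (tops ++ (left ++ right))             ≡⟨ filter-++ ∁P? tops (left ++ right) ⟩
      filter ∁P? tops ++ filter ∁P? (left ++ right)    ≡⟨ cong₂ _++_ (filter-all ∁P? tops-not-left)
                                                                      (filter-++ ∁P? left right) ⟩
      tops ++ (filter ∁P? left ++ filter ∁P? right)    ≡⟨ cong (tops ++_)
                                                            (cong₂ _++_ (filter-none ∁P? (All.map (λ p ¬p → ¬p p) left-is-left))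
                                                                        (filter-all ∁P? right-not-left)) ⟩
      tops ++ right                                    ∎
      where
      open ≡-Reasoning
      ∁P? = ∁? (botLeftOf? c)

  AllJoinable-afterBottom : AllJoinable (avoid s φ) (tops ++ right)
  AllJoinable-afterBottom {u} {v} u∈ v∈ =
    trans (avoid-disjoint s φ (misses-right u v (outer u∈) (outer v∈)))
          (joinable (rest⊆ (outer⊆rest u∈)) (rest⊆ (outer⊆rest v∈)))

  join-bottomPartner : join φ (top p) (bot c , rest) ≡ (if even t then #nc (avoid s φ) (tops ++ right) else 0)
  join-bottomPartner rewrite joinable (here refl) (there (∈-++⁺ʳ tops (∈-++⁺ʳ left (here refl)))) = begin
    #nc (avoid s φ) rest
      ≡⟨ #nc-split (botLeftOf? c) (avoid s φ) rest unjoinable noninterfering ⟩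
    #nc (avoid s φ) (filter (botLeftOf? c) rest) * #nc (avoid s φ) (filter (∁? (botLeftOf? c)) rest)
      ≡⟨ cong₂ (λ xs ys → #nc (avoid s φ) xs * #nc (avoid s φ) ys) filter-left filter-outer ⟩
    #nc (avoid s φ) left * #nc (avoid s φ) (tops ++ right)
      ≡⟨ cong (_* #nc (avoid s φ) (tops ++ right)) (#nc-dominoes q t (avoid s φ) leftJoinable) ⟩
    (if even t then 1 else 0) * #nc (avoid s φ) (tops ++ right)
      ≡⟨ trans (if-* (even t) 1 (#nc (avoid s φ) (tops ++ right))) (cong (if even t then_else 0) (ℕ.*-identityˡ _)) ⟩
    (if even t then #nc (avoid s φ) (tops ++ right) else 0) ∎
    where
    open ≡-Reasoning
    leftJoinable : AllJoinable (avoid s φ) left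
    leftJoinable u∈ v∈ with left-of-c u∈ | left-of-c v∈
    ... | b , refl , b<c | b′ , refl , b′<c =
      trans (avoid-disjoint s φ (misses-left {p} b b′ b<c b′<c)) (joinable (rest⊆ (left⊆rest u∈)) (rest⊆ (left⊆rest v∈)))

-- Compositions with parts at least 2

excess : List ℕ → ℕ
excess = ∑ (_∸ 2)

isComp : ℕ → List ℕ → Bool
isComp m l = does (isCompositionGe2? m l)

∑Comp : ℕ → ℕ → ℕ → (List ℕ → ℕ) → ℕ
∑Comp L B m w = ∑ (λ l → if isComp m l then w l else 0) (boundedLists L B)

≡ᵇ-+-split : ∀ x y m → (x + y ≡ᵇ m) ≡ (x ≤ᵇ m) ∧ (y ≡ᵇ m ∸ x)
≡ᵇ-+-split zero    y m       = refl
≡ᵇ-+-split (suc x) y zero    = refl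
≡ᵇ-+-split (suc x) y (suc m) = trans (≡ᵇ-+-split x y m) (cong (_∧ (y ≡ᵇ m ∸ x)) (x≤ᵇm≡x<ᵇ1+m x m))
  where
  x≤ᵇm≡x<ᵇ1+m : ∀ x m → (x ≤ᵇ m) ≡ (x <ᵇ suc m)
  x≤ᵇm≡x<ᵇ1+m zero    m = refl
  x≤ᵇm≡x<ᵇ1+m (suc x) m = refl

isComp-∷ : ∀ m x l → isComp m (x ∷ l) ≡ ((2 ≤ᵇ x) ∧ (x ≤ᵇ m)) ∧ isComp (m ∸ x) l
isComp-∷ m x l rewrite ≡ᵇ-+-split x (sum l) m =
  ∧-interchange (2 ≤ᵇ x) (does (all? (2 ≤?_) l)) (x ≤ᵇ m) (sum l ≡ᵇ m ∸ x)

byFirstPart : ℕ → ℕ → ℕ → (List ℕ → ℕ) → ℕ → ℕ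
byFirstPart L B m w x = if (2 ≤ᵇ x) ∧ (x ≤ᵇ m) then ∑Comp L B (m ∸ x) (w ∘ (x ∷_)) else 0

∑Comp-∷ : ∀ L B m w → ∑Comp (suc L) B m w ≡ (if isComp m [] then w [] else 0) + ∑< (suc B) (byFirstPart L B m w)
∑Comp-∷ L B m w = cong (_ +_) (begin
  ∑ f (concatMap (λ x → map (x ∷_) (boundedLists L B)) (upTo (suc B)))
    ≡⟨ ∑-concatMap f (λ x → map (x ∷_) (boundedLists L B)) (upTo (suc B)) ⟩
  ∑ (λ x → ∑ f (map (x ∷_) (boundedLists L B))) (upTo (suc B))
    ≡⟨ ∑-cong withFirstPart (upTo (suc B)) ⟩
  ∑ (byFirstPart L B m w) (upTo (suc B))
    ≡⟨ ∑<-upTo (suc B) (byFirstPart L B m w) ⟩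
  ∑< (suc B) (byFirstPart L B m w) ∎)
  where
  open ≡-Reasoning
  f : List ℕ → ℕ
  f l = if isComp m l then w l else 0
  withFirstPart : ∀ x → ∑ f (map (x ∷_) (boundedLists L B)) ≡ byFirstPart L B m w x
  withFirstPart x = begin
    ∑ f (map (x ∷_) (boundedLists L B))
      ≡⟨ ∑-map f (x ∷_) (boundedLists L B) ⟩
    ∑ (λ l → if isComp m (x ∷ l) then w (x ∷ l) else 0) (boundedLists L B)
      ≡⟨ ∑-cong (λ l → trans (cong (if_then w (x ∷ l) else 0) (isComp-∷ m x l)) (if-∧ ((2 ≤ᵇ x) ∧ (x ≤ᵇ m)) _))
                (boundedLists L B) ⟩
    ∑ (λ l → if (2 ≤ᵇ x) ∧ (x ≤ᵇ m) then (if isComp (m ∸ x) l then w (x ∷ l) else 0) else 0) (boundedLists L B)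
      ≡⟨ ∑-if ((2 ≤ᵇ x) ∧ (x ≤ᵇ m)) _ (boundedLists L B) ⟩
    byFirstPart L B m w x ∎

∑Comp-0 : ∀ L B w → ∑Comp L B 0 w ≡ w []
∑Comp-0 zero    B w = ℕ.+-identityʳ (w [])
∑Comp-0 (suc L) B w =
  trans (∑Comp-∷ L B 0 w) (trans (cong (w [] +_) (∑<-≡0 (suc B) noFirstPart)) (ℕ.+-identityʳ (w [])))
  where
  noFirstPart : ∀ x → byFirstPart L B 0 w x ≡ 0
  noFirstPart zero          = refl
  noFirstPart (suc zero)    = refl
  noFirstPart (suc (suc x)) = refl

∑Comp-bounds : ∀ L L′ B B′ m w → m ≤ L → m ≤ L′ → m ≤ B → m ≤ B′ → ∑Comp L B m w ≡ ∑Comp L′ B′ m w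
∑Comp-bounds L       L′       B B′ zero    w _         _          _   _    = trans (∑Comp-0 L B w) (sym (∑Comp-0 L′ B′ w))
∑Comp-bounds (suc L) (suc L′) B B′ (suc m) w (s≤s m≤L) (s≤s m≤L′) m<B m<B′ = begin
  ∑Comp (suc L) B (suc m) w                       ≡⟨ ∑Comp-∷ L B (suc m) w ⟩
  ∑< (suc B) (byFirstPart L B (suc m) w)          ≡⟨ ∑<-truncate (suc (suc m)) (suc B) _ (s≤s m<B) (tooBig L B) ⟩
  ∑< (suc (suc m)) (byFirstPart L B (suc m) w)    ≡⟨ ∑<-cong (suc (suc m)) (λ {x} _ → sameRest x) ⟩
  ∑< (suc (suc m)) (byFirstPart L′ B′ (suc m) w)  ≡⟨ ∑<-truncate (suc (suc m)) (suc B′) _ (s≤s m<B′) (tooBig L′ B′) ⟨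
  ∑< (suc B′) (byFirstPart L′ B′ (suc m) w)       ≡⟨ sym (∑Comp-∷ L′ B′ (suc m) w) ⟩
  ∑Comp (suc L′) B′ (suc m) w                     ∎
  where
  open ≡-Reasoning
  tooBig : ∀ L B {x} → suc (suc m) ≤ x → byFirstPart L B (suc m) w x ≡ 0
  tooBig L B {x} m+1<x rewrite ≤ᵇ-false m+1<x | Bool.∧-zeroʳ (2 ≤ᵇ x) = refl
  sameRest : ∀ x → byFirstPart L B (suc m) w x ≡ byFirstPart L′ B′ (suc m) w x
  sameRest zero    = refl
  sameRest (suc x) with (2 ≤ᵇ suc x) ∧ (suc x ≤ᵇ suc m)
  ... | false = refl
  ... | true  = ∑Comp-bounds L L′ B B′ (m ∸ x) (w ∘ (suc x ∷_))
                  (rest≤ m≤L) (rest≤ m≤L′) (rest≤ (ℕ.<⇒≤ m<B)) (rest≤ (ℕ.<⇒≤ m<B′))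
    where
    rest≤ : ∀ {K} → m ≤ K → m ∸ x ≤ K
    rest≤ = ℕ.≤-trans (ℕ.m∸n≤m m x)

excessIs : ℕ → List ℕ → ℕ
excessIs c l = if excess l ≡ᵇ c then 1 else 0

#excess : ℕ → ℕ → ℕ
#excess m c = ∑Comp m m m (excessIs c)

#excess-0 : ∀ c → #excess 0 c ≡ (if 0 ≡ᵇ c then 1 else 0)
#excess-0 c = ℕ.+-identityʳ _

#excess-1 : ∀ c → #excess 1 c ≡ 0
#excess-1 c = ∑Comp-∷ 0 1 1 (excessIs c)

-- A composition of m + 2 starts either with the part 2, followed by a
-- composition of m of the same excess, or with a part 3 + x.
#excess-2+ : ∀ m c →
  #excess (2 + m) c ≡ #excess m c + ∑< m (λ x → byFirstPart (1 + m) (2 + m) (2 + m) (excessIs c) (3 + x))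
#excess-2+ m c = trans (∑Comp-∷ (1 + m) (2 + m) (2 + m) (excessIs c))
  (cong (_+ ∑< m (λ x → byFirstPart (1 + m) (2 + m) (2 + m) (excessIs c) (3 + x)))
        (∑Comp-bounds (1 + m) m (2 + m) m m (excessIs c) (ℕ.n≤1+n m) ℕ.≤-refl (ℕ.m≤n+m m 2) ℕ.≤-refl))

#excess-2+-0 : ∀ m → #excess (2 + m) 0 ≡ #excess m 0
#excess-2+-0 m = trans (#excess-2+ m 0) (trans (cong (#excess m 0 +_) (∑<-≡0 m noExcessLeft)) (ℕ.+-identityʳ _))
  where
  noExcessLeft : ∀ x → byFirstPart (1 + m) (2 + m) (2 + m) (excessIs 0) (3 + x) ≡ 0
  noExcessLeft x = if-zero ((2 ≤ᵇ 3 + x) ∧ (3 + x ≤ᵇ 2 + m))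
    (∑-≡0 (boundedLists (1 + m) (2 + m)) λ {l} _ → if-zero (isComp (m ∸ suc x) l) refl)

-- Lowering the first part 3 + x by one gives a composition of m + 1 of excess one less.
#excess-2+-suc : ∀ m c → #excess (2 + m) (suc c) ≡ #excess m (suc c) + #excess (1 + m) c
#excess-2+-suc m c = trans (#excess-2+ m (suc c)) (cong (#excess m (suc c) +_) (begin
  ∑< m (λ x → byFirstPart (1 + m) (2 + m) (2 + m) (excessIs (suc c)) (3 + x))
    ≡⟨ ∑<-cong m (λ {x} _ → cong (if _ then_else 0)
         (∑Comp-bounds (1 + m) m (2 + m) (1 + m) (m ∸ suc x) _
           (rest≤ (ℕ.n≤1+n m)) (rest≤ ℕ.≤-refl) (rest≤ (ℕ.m≤n+m m 2)) (rest≤ (ℕ.n≤1+n m)))) ⟩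
  ∑< m (λ x → byFirstPart m (1 + m) (1 + m) (excessIs c) (2 + x))
    ≡⟨ sym (∑Comp-∷ m (1 + m) (1 + m) (excessIs c)) ⟩
  #excess (1 + m) c ∎))
  where
  open ≡-Reasoning
  rest≤ : ∀ {x K} → m ≤ K → m ∸ suc x ≤ K
  rest≤ {x} = ℕ.≤-trans (ℕ.m∸n≤m m (suc x))

#excess-2-0 : #excess 2 0 ≡ 1
#excess-2-0 = trans (#excess-2+-0 0) (#excess-0 0)

#excess-2-suc : ∀ c → #excess 2 (suc c) ≡ 0
#excess-2-suc c = trans (#excess-2+-suc 0 c) (cong₂ _+_ (#excess-0 (suc c)) (#excess-1 c))

#excess-3-0 : #excess 3 0 ≡ 0
#excess-3-0 = trans (#excess-2+-0 1) (#excess-1 0)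

#excess-3-suc : ∀ c → #excess 3 (suc c) ≡ #excess 2 c
#excess-3-suc c = trans (#excess-2+-suc 1 c) (cong (_+ #excess 2 c) (#excess-1 (suc c)))

#excess-2+-0-even : ∀ k → #excess (2 + k) 0 ≡ (if even k then 1 else 0)
#excess-2+-0-even zero          = #excess-2-0
#excess-2+-0-even (suc zero)    = #excess-3-0
#excess-2+-0-even (suc (suc k)) = trans (#excess-2+-0 (2 + k)) (#excess-2+-0-even k)

#excess≡∑ : ∀ m c → #excess m c ≡ ∑ (excessIs c) (compositionsGe2 m)
#excess≡∑ m c = sym (∑-filter (isCompositionGe2? m) (excessIs c) (boundedLists m m))

length-excess : ∀ l → All (2 ≤_) l → 2 * length l + excess l ≡ sum l
length-excess []      _            = refl
length-excess (x ∷ l) (2≤x All.∷ 2≤l) = begin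
  2 * suc (length l) + (x ∸ 2 + excess l)   ≡⟨ regroup (length l) (x ∸ 2) (excess l) ⟩
  (2 + (x ∸ 2)) + (2 * length l + excess l) ≡⟨ cong₂ _+_ (ℕ.m+[n∸m]≡n 2≤x) (length-excess l 2≤l) ⟩
  x + sum l                                 ∎
  where
  open ≡-Reasoning
  regroup : ∀ a d e → 2 * suc a + (d + e) ≡ (2 + d) + (2 * a + e)
  regroup = solve 3 (λ a d e → con 2 :* (con 1 :+ a) :+ (d :+ e) := (con 2 :+ d) :+ (con 2 :* a :+ e)) refl

composition-length-excess : ∀ m {l} → l ∈ compositionsGe2 m → 2 * length l + excess l ≡ m
composition-length-excess m l∈ with ∈-filter⁻ (isCompositionGe2? m) {xs = boundedLists m m} l∈
... | _ , 2≤l , sum≡m = trans (length-excess _ 2≤l) sum≡m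

-- The strip count as a sum over excesses

-- B only cuts off the range of c; any B > k gives the whole sum, as the excess
-- of a composition of k + 2 is at most k.
diag offDiag : ℕ → ℕ → ℕ → ℕ
diag    B k n = ∑< B (λ c → #excess (2 + k) c * #excess (2 + n) c)
offDiag B k n = ∑< B (λ c → #excess (2 + k) c * #excess (2 + n) (suc c))

diag-0 : ∀ B n → diag (suc B) 0 n ≡ (if even n then 1 else 0)
diag-0 B n = begin
  #excess 2 0 * #excess (2 + n) 0 + ∑< B (λ c → #excess 2 (suc c) * #excess (2 + n) (suc c))
    ≡⟨ cong₂ _+_ (trans (cong (_* #excess (2 + n) 0) #excess-2-0) (ℕ.*-identityˡ _))
                 (∑<-≡0 B (λ c → cong (_* #excess (2 + n) (suc c)) (#excess-2-suc c))) ⟩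
  #excess (2 + n) 0 + 0
    ≡⟨ trans (ℕ.+-identityʳ _) (#excess-2+-0-even n) ⟩
  (if even n then 1 else 0) ∎
  where open ≡-Reasoning

diag-1 : ∀ B n → diag (suc B) 1 n ≡ offDiag B 0 n
diag-1 B n = cong₂ _+_ (cong (_* #excess (2 + n) 0) #excess-3-0)
                       (∑<-cong B (λ {c} _ → cong (_* #excess (2 + n) (suc c)) (#excess-3-suc c)))

diag-2+ : ∀ B k n → diag (suc B) (2 + k) n ≡ diag (suc B) k n + offDiag B (1 + k) n
diag-2+ B k n = begin
  #excess (4 + k) 0 * N 0 + ∑< B (λ c → #excess (4 + k) (suc c) * N (suc c))
    ≡⟨ cong₂ _+_ (cong (_* N 0) (#excess-2+-0 (2 + k))) (∑<-cong B (λ {c} _ → byExcess c)) ⟩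
  #excess (2 + k) 0 * N 0 + ∑< B (λ c → #excess (2 + k) (suc c) * N (suc c) + #excess (3 + k) c * N (suc c))
    ≡⟨ cong (#excess (2 + k) 0 * N 0 +_)
            (∑<-distrib-+ B (λ c → #excess (2 + k) (suc c) * N (suc c)) (λ c → #excess (3 + k) c * N (suc c))) ⟩
  #excess (2 + k) 0 * N 0 + (∑< B (λ c → #excess (2 + k) (suc c) * N (suc c)) + offDiag B (1 + k) n)
    ≡⟨ sym (ℕ.+-assoc (#excess (2 + k) 0 * N 0) _ _) ⟩
  diag (suc B) k n + offDiag B (1 + k) n ∎
  where
  open ≡-Reasoning
  N = #excess (2 + n)
  byExcess : ∀ c → #excess (4 + k) (suc c) * N (suc c)
                   ≡ #excess (2 + k) (suc c) * N (suc c) + #excess (3 + k) c * N (suc c)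
  byExcess c = trans (cong (_* N (suc c)) (#excess-2+-suc (2 + k) c))
                     (ℕ.*-distribʳ-+ (N (suc c)) (#excess (2 + k) (suc c)) (#excess (3 + k) c))

offDiag-0 : ∀ B k → offDiag B k 0 ≡ 0
offDiag-0 B k = ∑<-≡0 B (λ c → trans (cong (#excess (2 + k) c *_) (#excess-2-suc c)) (ℕ.*-zeroʳ (#excess (2 + k) c)))

offDiag-1 : ∀ B k → offDiag B k 1 ≡ diag B k 0
offDiag-1 B k = ∑<-cong B (λ {c} _ → cong (#excess (2 + k) c *_) (#excess-3-suc c))

offDiag-2+ : ∀ B k n → offDiag B k (2 + n) ≡ diag B k (1 + n) + offDiag B k n
offDiag-2+ B k n = trans (∑<-cong B (λ {c} _ → byExcess c))
                         (∑<-distrib-+ B (λ c → K c * #excess (3 + n) c) (λ c → K c * #excess (2 + n) (suc c)))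
  where
  K = #excess (2 + k)
  byExcess : ∀ c → K c * #excess (4 + n) (suc c) ≡ K c * #excess (3 + n) c + K c * #excess (2 + n) (suc c)
  byExcess c = trans (cong (K c *_) (#excess-2+-suc (2 + n) c))
                     (trans (ℕ.*-distribˡ-+ (K c) (#excess (2 + n) (suc c)) (#excess (3 + n) c))
                            (ℕ.+-comm (K c * #excess (2 + n) (suc c)) _))

-- The first top point joined to one of n bottom points, the j-th of which has
-- t + j bottom points on its left.
∑partners : ℕ → ℕ → ℕ → ℕ → ℕ
∑partners B k t zero    = 0
∑partners B k t (suc n) = (if even t then diag B k n else 0) + ∑partners B k (suc t) n

∑partners-2+ : ∀ B k t n → ∑partners B k (2 + t) n ≡ ∑partners B k t n
∑partners-2+ B k t zero    = refl
∑partners-2+ B k t (suc n) = cong ((if even t then diag B k n else 0) +_) (∑partners-2+ B k (suc t) n)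

∑partners≡offDiag : ∀ B k n → ∑partners B k 0 n ≡ offDiag B k n
∑partners≡offDiag B k zero          = sym (offDiag-0 B k)
∑partners≡offDiag B k (suc zero)    = trans (ℕ.+-identityʳ (diag B k 0)) (sym (offDiag-1 B k))
∑partners≡offDiag B k (suc (suc n)) =
  trans (cong (diag B k (suc n) +_) (trans (∑partners-2+ B k 0 n) (∑partners≡offDiag B k n))) (sym (offDiag-2+ B k n))

mutual
  #nc-strip : ∀ B k p q n φ → k < B → AllJoinable φ (topsFrom p k ++ botsFrom q n) →
              #nc φ (topsFrom p k ++ botsFrom q n) ≡ diag B k n
  #nc-strip (suc B) zero    p q n φ _         joinable = trans (#nc-dominoes q n φ joinable) (sym (diag-0 B n))
  #nc-strip (suc B) (suc k) p q n φ (s≤s k<B) joinable = begin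
    #nc φ (top p ∷ tops ++ bots)
      ≡⟨ #nc-∷ φ (top p) (tops ++ bots) ⟩
    ∑ (join φ (top p)) (choices (tops ++ bots))
      ≡⟨ cong (∑ (join φ (top p))) (choices-++ tops bots) ⟩
    ∑ (join φ (top p)) (map (map₂ (_++ bots)) (choices tops) ++ map (map₂ (tops ++_)) (choices bots))
      ≡⟨ ∑-++ (join φ (top p)) (map (map₂ (_++ bots)) (choices tops)) (map (map₂ (tops ++_)) (choices bots)) ⟩
    ∑ (join φ (top p)) (map (map₂ (_++ bots)) (choices tops)) + ∑ (join φ (top p)) (map (map₂ (tops ++_)) (choices bots))
      ≡⟨ cong (∑ (join φ (top p)) (map (map₂ (_++ bots)) (choices tops)) +_) bottomPartners ⟩
    ∑ (join φ (top p)) (map (map₂ (_++ bots)) (choices tops)) + offDiag B k n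
      ≡⟨ topPartner k k<B joinable ⟩
    diag (suc B) (suc k) n ∎
    where
    open ≡-Reasoning
    tops = topsFrom (suc p) k
    bots = botsFrom q n
    bottomPartners : ∑ (join φ (top p)) (map (map₂ (tops ++_)) (choices bots)) ≡ offDiag B k n
    bottomPartners = trans (∑-map (join φ (top p)) (map₂ (tops ++_)) (choices bots))
      (trans (#nc-strip-bottom B k p q 0 q n φ (sym (ℕ.+-identityʳ q)) k<B joinable) (∑partners≡offDiag B k n))
    topPartner : ∀ k → k < B → AllJoinable φ (topsFrom p (suc k) ++ bots) →
      ∑ (join φ (top p)) (map (map₂ (_++ bots)) (choices (topsFrom (suc p) k))) + offDiag B k n ≡ diag (suc B) (suc k) n
    topPartner zero    _   _        = sym (diag-1 B n)
    topPartner (suc k) k<B joinable = begin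
      ∑ (join φ (top p)) (map (map₂ (_++ bots)) (choices (topsFrom (suc p) (suc k)))) + offDiag B (suc k) n
        ≡⟨ cong (_+ offDiag B (suc k) n) (∑join-topPartner φ p k q n joinable) ⟩
      #nc (avoid (segment (top p , top (suc p))) φ) (topsFrom (2 + p) k ++ bots) + offDiag B (suc k) n
        ≡⟨ cong (_+ offDiag B (suc k) n)
             (#nc-strip (suc B) k (2 + p) q n _ (ℕ.m<n⇒m<1+n (ℕ.<-trans (ℕ.n<1+n k) k<B))
                        (AllJoinable-topNeighbour φ p k q n joinable)) ⟩
      diag (suc B) k n + offDiag B (suc k) n
        ≡⟨ sym (diag-2+ B k n) ⟩
      diag (suc B) (2 + k) n ∎

  #nc-strip-bottom : ∀ B k p q t c n φ → c ≡ q + t → k < B →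
    AllJoinable φ (top p ∷ topsFrom (suc p) k ++ (botsFrom q t ++ botsFrom c n)) →
    ∑ (λ pr → join φ (top p) (proj₁ pr , topsFrom (suc p) k ++ (botsFrom q t ++ proj₂ pr))) (choices (botsFrom c n))
      ≡ ∑partners B k t n
  #nc-strip-bottom B k p q t c zero    φ _      _   _        = refl
  #nc-strip-bottom B k p q t c (suc n) φ c≡q+t k<B joinable = cong₂ _+_ partnerHere partnerFurther
    where
    tops = topsFrom (suc p) k
    f : Pt × List Pt → ℕ
    f pr = join φ (top p) (proj₁ pr , tops ++ (botsFrom q t ++ proj₂ pr))
    partnerHere : f (bot c , botsFrom (suc c) n) ≡ (if even t then diag B k n else 0)
    partnerHere = trans (join-bottomPartner φ p k q t c n c≡q+t joinable)
      (cong (if even t then_else 0)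
        (#nc-strip B k (suc p) (suc c) n _ k<B (AllJoinable-afterBottom φ p k q t c n c≡q+t joinable)))
    shifted : ∀ r → botsFrom q t ++ (bot c ∷ r) ≡ botsFrom q (suc t) ++ r
    shifted r = botsFrom-++-∷ q t c r c≡q+t
    partnerFurther : ∑ f (map (map₂ (bot c ∷_)) (choices (botsFrom (suc c) n))) ≡ ∑partners B k (suc t) n
    partnerFurther = begin
      ∑ f (map (map₂ (bot c ∷_)) (choices (botsFrom (suc c) n)))
        ≡⟨ ∑-map f (map₂ (bot c ∷_)) (choices (botsFrom (suc c) n)) ⟩
      ∑ (f ∘ map₂ (bot c ∷_)) (choices (botsFrom (suc c) n))
        ≡⟨ ∑-cong (λ pr → cong (λ bs → join φ (top p) (proj₁ pr , tops ++ bs)) (shifted (proj₂ pr)))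
                  (choices (botsFrom (suc c) n)) ⟩
      ∑ (λ pr → join φ (top p) (proj₁ pr , tops ++ (botsFrom q (suc t) ++ proj₂ pr))) (choices (botsFrom (suc c) n))
        ≡⟨ #nc-strip-bottom B k p q (suc t) (suc c) n φ (trans (cong suc c≡q+t) (sym (ℕ.+-suc q t))) k<B
             (subst (λ bs → AllJoinable φ (top p ∷ tops ++ bs)) (shifted (botsFrom (suc c) n)) joinable) ⟩
      ∑partners B k (suc t) n ∎
      where open ≡-Reasoning

length≡⇔excess≡ : ∀ {m s L₁ L₂ E₁ E₂} → 2 * L₁ + E₁ ≡ m → 2 * L₂ + E₂ ≡ m + s * 2 →
                  (L₂ ≡ s + L₁) ⇔ (E₂ ≡ E₁)
length≡⇔excess≡ {m} {s} {L₁} {L₂} {E₁} {E₂} sum₁ sum₂ = mk⇔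
  (λ { refl → ℕ.+-cancelˡ-≡ (2 * (s + L₁)) E₂ E₁ same })
  (λ { refl → ℕ.*-cancelˡ-≡ L₂ (s + L₁) 2 (ℕ.+-cancelʳ-≡ E₂ (2 * L₂) (2 * (s + L₁)) same) })
  where
  same : 2 * L₂ + E₂ ≡ 2 * (s + L₁) + E₁
  same = trans sum₂ (trans (cong (_+ s * 2) (sym sum₁)) (regroup s L₁ E₁))
    where
    regroup : ∀ s L E → (2 * L + E) + s * 2 ≡ 2 * (s + L) + E
    regroup = solve 3 (λ s L E → (con 2 :* L :+ E) :+ s :* con 2 := con 2 :* (s :+ L) :+ E) refl

#pairs≡diag : ∀ k n s → n ≡ k + s * 2 →
  length (filter (λ c → length (proj₂ c) ≟ s + length (proj₁ c))
                 (cartesianProduct (compositionsGe2 (2 + k)) (compositionsGe2 (2 + n))))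
    ≡ diag (3 + k) k n
#pairs≡diag k n s n≡k+2s = begin
  length (filter related? (cartesianProduct C₁ C₂))
    ≡⟨ length-filter related? (cartesianProduct C₁ C₂) ⟩
  ∑ [related] (cartesianProduct C₁ C₂)
    ≡⟨ ∑-cartesianProduct [related] C₁ C₂ ⟩
  ∑ (λ c₁ → ∑ (λ c₂ → [related] (c₁ , c₂)) C₂) C₁
    ≡⟨ ∑-cong-∈ C₁ partners ⟩
  ∑ (#excess (2 + n) ∘ excess) C₁
    ≡⟨ ∑-fibres excess (#excess (2 + n)) (3 + k) C₁ excess<3+k ⟩
  ∑< (3 + k) (λ c → ∑ (excessIs c) C₁ * #excess (2 + n) c)
    ≡⟨ ∑<-cong (3 + k) (λ {c} _ → cong (_* #excess (2 + n) c) (sym (#excess≡∑ (2 + k) c))) ⟩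
  diag (3 + k) k n ∎
  where
  open ≡-Reasoning
  C₁ = compositionsGe2 (2 + k)
  C₂ = compositionsGe2 (2 + n)
  related? = λ (c : List ℕ × List ℕ) → length (proj₂ c) ≟ s + length (proj₁ c)
  [related] : List ℕ × List ℕ → ℕ
  [related] c = if does (related? c) then 1 else 0

  excess<3+k : ∀ {c} → c ∈ C₁ → excess c < 3 + k
  excess<3+k {c} c∈ = s≤s (subst (excess c ≤_) (composition-length-excess (2 + k) c∈) (ℕ.m≤n+m (excess c) (2 * length c)))

  partners : ∀ {c₁} → c₁ ∈ C₁ → ∑ (λ c₂ → [related] (c₁ , c₂)) C₂ ≡ #excess (2 + n) (excess c₁)
  partners {c₁} c₁∈ = trans (∑-cong-∈ C₂ sameExcess) (sym (#excess≡∑ (2 + n) (excess c₁)))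
    where
    sameExcess : ∀ {c₂} → c₂ ∈ C₂ → [related] (c₁ , c₂) ≡ excessIs (excess c₁) c₂
    sameExcess {c₂} c₂∈ = cong (if_then 1 else 0)
      (does-⇔ (length≡⇔excess≡ {s = s} {L₁ = length c₁} (composition-length-excess (2 + k) c₁∈)
                 (trans (composition-length-excess (2 + n) c₂∈) (cong (2 +_) n≡k+2s)))
              (length c₂ ≟ s + length c₁) (excess c₂ ≟ excess c₁))

half-difference : ∀ k n → n % 2 ≡ k % 2 → k ≤ n → n ≡ k + ((n ∸ k) / 2) * 2
half-difference k n n%2≡k%2 k≤n = begin
  n                           ≡⟨ sym (ℕ.m+[n∸m]≡n k≤n) ⟩
  k + (n ∸ k)                 ≡⟨ cong (k +_) (trans n∸k≡2d (cong (_* 2) (sym (m*n/n≡m d 2)))) ⟩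
  k + ((d * 2) / 2) * 2       ≡⟨ cong (λ x → k + (x / 2) * 2) (sym n∸k≡2d) ⟩
  k + ((n ∸ k) / 2) * 2       ∎
  where
  open ≡-Reasoning
  d = n / 2 ∸ k / 2
  n∸k≡2d : n ∸ k ≡ d * 2
  n∸k≡2d = begin
    n ∸ k                                        ≡⟨ cong₂ _∸_ (m≡m%n+[m/n]*n n 2) (m≡m%n+[m/n]*n k 2) ⟩
    (n % 2 + (n / 2) * 2) ∸ (k % 2 + (k / 2) * 2) ≡⟨ cong (λ r → (r + (n / 2) * 2) ∸ (k % 2 + (k / 2) * 2)) n%2≡k%2 ⟩
    (k % 2 + (n / 2) * 2) ∸ (k % 2 + (k / 2) * 2) ≡⟨ ℕ.[m+n]∸[m+o]≡n∸o (k % 2) _ _ ⟩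
    (n / 2) * 2 ∸ (k / 2) * 2                    ≡⟨ sym (ℕ.*-distribʳ-∸ 2 (n / 2) (k / 2)) ⟩
    d * 2                                        ∎

mainTheorem5 : (k n : ℕ) → n % 2 ≡ k % 2 → k ≤ n →
    a k n ≡ length (filter (λ c → length (proj₂ c) ≟ ((n ∸ k) / 2) + length (proj₁ c))
                           (cartesianProduct (compositionsGe2 (k + 2)) (compositionsGe2 (n + 2))))
mainTheorem5 k n n%2≡k%2 k≤n rewrite ℕ.+-comm k 2 | ℕ.+-comm n 2 = begin
  a k n                                            ≡⟨ a≡#nc k n ⟩
  #nc (λ _ → true) (points k n)                    ≡⟨ cong (#nc (λ _ → true)) (points≡ k n) ⟩
  #nc (λ _ → true) (topsFrom 0 k ++ botsFrom 0 n)  ≡⟨ #nc-strip (3 + k) k 0 0 n (λ _ → true) k<3+k (λ _ _ → refl) ⟩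
  diag (3 + k) k n                                 ≡⟨ #pairs≡diag k n s (half-difference k n n%2≡k%2 k≤n) ⟨
  length (filter (λ c → length (proj₂ c) ≟ s + length (proj₁ c))
                 (cartesianProduct (compositionsGe2 (2 + k)) (compositionsGe2 (2 + n)))) ∎
  where
  open ≡-Reasoning
  s = (n ∸ k) / 2
  k<3+k = ℕ.m≤n+m (suc k) 2
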